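{- Let $q=e^{\pi i z}$ for $z$ in the upper half-plane, and let $\theta_2(z)=\sum_{n\in\mathbb{Z}+1/2}q^{n^2}$, $\theta_3(z)=\sum_{n\in\mathbb{Z}}q^{n^2}$, $\theta_4(z)=\sum_{n\in\mathbb{Z}}(-q)^{n^2}$, and $\Delta_8(z)=\frac{1}{16}\theta_2(z)^4\theta_4(z)^4$. Define integers $a(m)$ by $\theta_3(z)^2\Delta_8(z)=\sum_{m\ge1}a(m)q^m$. Then for every odd positive integer $m$, $a(m)\equiv\sigma_1(m)\pmod 4$, where $\sigma_1(m)=\sum_{0<d\mid m}d$. -}

module Defs where

open import Data.Nat as ℕ using (ℕ; zero; suc; _≟_)
open import Data.Nat.Divisibility as ℕD using (_∣?_)
open import Data.Integer as ℤ using (ℤ; +_; ∣_∣)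
import Data.List
open import Data.List using (List; map; upTo; filter)
open import Data.Nat.ListAction using (sum)
open import Relation.Nullary using (does)
open import Data.Bool using (if_then_else_)

Series : Set
Series = ℕ → ℤ

_⊛_ : Series → Series → Series
(f ⊛ g) N = Data.List.foldr ℤ._+_ (+ 0) (map (λ i → f i ℤ.* g (N ℕ.∸ i)) (upTo (suc N)))
infixl 7 _⊛_

pow : Series → ℕ → Series
pow f zero zero    = + 1
pow f zero (suc _) = + 0
pow f (suc k)      = f ⊛ pow f k

ints : ℕ → List ℤ
ints N = map (λ i → (+ i) ℤ.- (+ N)) (upTo (suc (N ℕ.* 2)))

sgn : ℕ → ℤ
sgn zero = + 1
sgn (suc k) = ℤ.- sgn k

-- The series  Σ_{n ∈ ℤ} w(n) t^{e(n)} , in the variable t, for an exponent map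
-- e with |n| ≤ e(n) whenever n ≠ 0 (so all n with e(n) = N lie in [-N, N]).
thetaLike : (ℤ → ℤ) → (ℤ → ℕ) → Series
thetaLike w e N = Data.List.foldr ℤ._+_ (+ 0) (map (λ n → if does (e n ≟ N) then w n else + 0) (ints N))

-- All theta series are written in the variable t = q^{1/4} = e^{πiz/4}.
-- θ₂ = Σ_{n ∈ ℤ+1/2} q^{n²} = Σ_{k ∈ ℤ} t^{(2k+1)²}
θ₂ : Series
θ₂ = thetaLike (λ _ → + 1) (λ k → ∣ (+ 2) ℤ.* k ℤ.+ (+ 1) ∣ ℕ.^ 2)

θ₃ : Series
θ₃ = thetaLike (λ _ → + 1) (λ n → 4 ℕ.* (∣ n ∣ ℕ.^ 2))

θ₄ : Series
θ₄ = thetaLike (λ n → sgn (∣ n ∣ ℕ.^ 2)) (λ n → 4 ℕ.* (∣ n ∣ ℕ.^ 2))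

sixteenθ₃²Δ₈ : Series
sixteenθ₃²Δ₈ = pow θ₃ 2 ⊛ pow θ₂ 4 ⊛ pow θ₄ 4

σ₁ : ℕ → ℕ
σ₁ m = sum (filter (λ d → d ∣? m) (map suc (upTo m)))

-- With t = q^{1/4} we have θ₂ = 2ψ for ψ = ∑_{k ≥ 0} t^{(2k+1)²}, so θ₃²Δ₈ = θ₃² ψ⁴ θ₄⁴. Modulo 2,
-- θ₃ ≡ θ₄ ≡ 1 and ψ² ≡ ψ(t²); squaring lifts this to θ₃²Δ₈ ≡ ψ(t²)² (mod 4), so a(m) ≡ r(2m) (mod 4),
-- where r(2m) counts the pairs (a , b) with (2a+1)² + (2b+1)² = 2m.
-- For odd m, the pairs with a < b correspond to the representations m = u² + v² with u < v, and hence
-- to the fixed points of (x , y , z) ↦ (x , z , y) on Zagier's set {x² + 4yz = m}. Off the boundary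
-- y = x + z the same set carries Zagier's windmill involution, whose fixed points are the
-- factorisations m = d e with d < e and e ≡ d (mod 4). Comparing the two involutions modulo 2 gives
-- r(2m) ≡ √m + 2·#{d < e : d e = m, 4 ∣ e - d} (mod 4), the √m term being present only for square m;
-- this is σ₁(m) modulo 4, because a pair d < e contributes d + e ≡ 2 or 0 (mod 4) according as 4 ∣ e - d.
{-# OPTIONS --safe #-}
module Submission where

open import Defs
open import Function using (_∘_)
open import Relation.Binary.PropositionalEquality
open import Data.Nat using (ℕ)

module Parity where

  open import Data.Nat using (ℕ; zero; suc; _+_; _*_; _%_; _/_; _≤_)
  open import Data.Nat.DivMod using (m≡m%n+[m/n]*n)
  import Data.Nat.Properties as ℕₚ
  open import Data.Nat.Tactic.RingSolver using (solve-∀)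
  open import Data.Product using (∃; _,_)
  open import Data.Sum using (_⊎_; inj₁; inj₂)
  open import Data.Empty using (⊥; ⊥-elim)
  open import Relation.Nullary using (¬_; yes; no)
  open import Relation.Unary using (Decidable)

  Even Odd : ℕ → Set
  Even n = ∃ λ k → n ≡ k + k
  Odd  n = ∃ λ k → n ≡ suc (k + k)

  even-or-odd : ∀ n → Even n ⊎ Odd n
  even-or-odd zero = inj₁ (0 , refl)
  even-or-odd (suc n) with even-or-odd n
  ... | inj₁ (k , refl) = inj₂ (k , refl)
  ... | inj₂ (k , refl) = inj₁ (suc k , cong suc (sym (ℕₚ.+-suc k k)))

  double-injective : ∀ {a b} → a + a ≡ b + b → a ≡ b
  double-injective {zero}  {zero}  eq = refl
  double-injective {suc a} {suc b} eq =
    cong suc (double-injective (ℕₚ.suc-injective (trans (sym (ℕₚ.+-suc a a)) (trans (ℕₚ.suc-injective eq) (ℕₚ.+-suc b b)))))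

  double-≤⇒≤ : ∀ {a b} → a + a ≤ b + b → a ≤ b
  double-≤⇒≤ {a} {b} le = subst₂ _≤_ (sym (ℕₚ.n≡⌊n+n/2⌋ a)) (sym (ℕₚ.n≡⌊n+n/2⌋ b)) (ℕₚ.⌊n/2⌋-mono le)

  even⇒¬odd : ∀ {n} → Even n → ¬ Odd n
  even⇒¬odd (k , refl) (j , eq) = parity-clash k j eq
    where
    parity-clash : ∀ k j → k + k ≡ suc (j + j) → ⊥
    parity-clash (suc k) zero    eq = ℕₚ.0≢1+n (sym (trans (sym (ℕₚ.+-suc k k)) (ℕₚ.suc-injective eq)))
    parity-clash (suc k) (suc j) eq =
      parity-clash k j (ℕₚ.suc-injective (trans (sym (ℕₚ.+-suc k k)) (trans (ℕₚ.suc-injective eq) (cong suc (ℕₚ.+-suc j j)))))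

  odd? : Decidable Odd
  odd? n with even-or-odd n
  ... | inj₁ even = no (even⇒¬odd even)
  ... | inj₂ odd  = yes odd

  even+even : ∀ {a b} → Even a → Even b → Even (a + b)
  even+even (k , refl) (j , refl) = k + j , shuffle k j
    where
    shuffle : ∀ k j → k + k + (j + j) ≡ k + j + (k + j)
    shuffle = solve-∀

  odd+odd : ∀ {a b} → Odd a → Odd b → Even (a + b)
  odd+odd (k , refl) (j , refl) = suc (k + j) , shuffle k j
    where
    shuffle : ∀ k j → suc (k + k) + suc (j + j) ≡ suc (k + j) + suc (k + j)
    shuffle = solve-∀

  odd+even : ∀ {a b} → Odd a → Even b → Odd (a + b)
  odd+even (k , refl) (j , refl) = k + j , shuffle k j
    where
    shuffle : ∀ k j → suc (k + k) + (j + j) ≡ suc (k + j + (k + j))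
    shuffle = solve-∀

  even*ˡ : ∀ {a} b → Even a → Even (a * b)
  even*ˡ b (k , refl) = k * b , ℕₚ.*-distribʳ-+ b k k

  odd*odd : ∀ {a b} → Odd a → Odd b → Odd (a * b)
  odd*odd (k , refl) (j , refl) = k + j + 2 * k * j , shuffle k j
    where
    shuffle : ∀ k j → suc (k + k) * suc (j + j) ≡ suc (k + j + 2 * k * j + (k + j + 2 * k * j))
    shuffle = solve-∀

  %2≡1⇒odd : ∀ n → n % 2 ≡ 1 → Odd n
  %2≡1⇒odd n n%2≡1 = n / 2 , trans (m≡m%n+[m/n]*n n 2) (trans (cong (_+ (n / 2) * 2) n%2≡1) (regroup (n / 2)))
    where
    regroup : ∀ k → 1 + k * 2 ≡ suc (k + k)
    regroup = solve-∀

  odd-square⇒odd : ∀ {a} → Odd (a * a) → Odd a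
  odd-square⇒odd {a} odd with even-or-odd a
  ... | inj₁ even  = ⊥-elim (even⇒¬odd (even*ˡ a even) odd)
  ... | inj₂ odd′ = odd′

module IntegerSums where

  open import Data.Nat as ℕ using (ℕ; zero; suc; _∸_; _<_; z≤n; s≤s; _≟_)
  import Data.Nat.Properties as ℕₚ
  open import Data.Integer using (ℤ; +_; _+_; _*_; -_; _-_)
  open import Data.Integer.Properties hiding (_≟_)
  open import Data.Integer.Divisibility.Signed using (_∣_; divides; ∣m∣n⇒∣m+n; ∣m⇒∣-m; ∣m⇒∣m*n; ∣n⇒∣m*n)
  open import Data.Integer.DivMod using (_%ℕ_; _/ℕ_; n%ℕd<d; a≡a%ℕn+[a/ℕn]*n)
  open import Data.Integer.Tactic.RingSolver using (solve-∀)
  open import Data.List using (map; applyUpTo; foldr)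
  open import Data.Bool using (if_then_else_)
  open import Relation.Nullary using (Dec; does; yes; no; ¬_; contradiction)
  open ≡-Reasoning

  indicator : ∀ {X : Set} → Dec X → ℤ
  indicator d = if does d then + 1 else + 0

  indicator-yes : ∀ {X : Set} (d : Dec X) → X → indicator d ≡ + 1
  indicator-yes (yes _) _ = refl
  indicator-yes (no ¬x) x = contradiction x ¬x

  indicator-no : ∀ {X : Set} (d : Dec X) → ¬ X → indicator d ≡ + 0
  indicator-no (yes x) ¬x = contradiction x ¬x
  indicator-no (no _)  _  = refl

  ∑< : ℕ → (ℕ → ℤ) → ℤ
  ∑< zero    h = + 0
  ∑< (suc n) h = h 0 + ∑< n (h ∘ suc)

  infix 6 ∑<
  syntax ∑< n (λ i → e) = ∑[ i < n ] e

  -- A record rather than a synonym for k ∣ a - b, so that a, b and k can be inferred.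
  infix 4 _≡_[mod_]
  record _≡_[mod_] (a b k : ℤ) : Set where
    constructor mod
    field
      divides-difference : k ∣ a - b
  open _≡_[mod_] public

  ≡⇒≡-mod : ∀ {a b k} → a ≡ b → a ≡ b [mod k ]
  ≡⇒≡-mod {a} {k = k} refl = mod (divides (+ 0) (trans (+-inverseʳ a) (sym (*-zeroˡ k))))

  mod-sym : ∀ {a b k} → a ≡ b [mod k ] → b ≡ a [mod k ]
  mod-sym {a} {b} (mod a≡b) = mod (subst (_ ∣_) (shuffle a b) (∣m⇒∣-m a≡b))
    where
    shuffle : ∀ a b → - (a - b) ≡ b - a
    shuffle = solve-∀

  mod-trans : ∀ {a b c k} → a ≡ b [mod k ] → b ≡ c [mod k ] → a ≡ c [mod k ]
  mod-trans {a} {b} {c} (mod a≡b) (mod b≡c) = mod (subst (_ ∣_) (telescope a b c) (∣m∣n⇒∣m+n a≡b b≡c))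
    where
    telescope : ∀ a b c → a - b + (b - c) ≡ a - c
    telescope = solve-∀

  +-mod : ∀ {a a′ b b′ k} → a ≡ a′ [mod k ] → b ≡ b′ [mod k ] → a + b ≡ a′ + b′ [mod k ]
  +-mod {a} {a′} {b} {b′} (mod a≡a′) (mod b≡b′) = mod (subst (_ ∣_) (interchange a a′ b b′) (∣m∣n⇒∣m+n a≡a′ b≡b′))
    where
    interchange : ∀ a a′ b b′ → a - a′ + (b - b′) ≡ a + b - (a′ + b′)
    interchange = solve-∀

  a+k*x≡b+k*y⇒a≡b-mod : ∀ {a b x y} k → a ℕ.+ k ℕ.* x ≡ b ℕ.+ k ℕ.* y → + a ≡ + b [mod + k ]
  a+k*x≡b+k*y⇒a≡b-mod {a} {b} {x} {y} k eq = mod (divides (+ y - + x) (begin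
    + a - + b                                                    ≡⟨ rearrange (+ a) (+ b) (+ k) (+ x) (+ y) ⟩
    (+ a + + k * + x) - (+ b + + k * + y) + (+ y - + x) * + k    ≡⟨ cong (_+ (+ y - + x) * + k) both-sides ⟩
    + 0 + (+ y - + x) * + k                                      ≡⟨ +-identityˡ _ ⟩
    (+ y - + x) * + k                                            ∎))
    where
    rearrange : ∀ a b k x y → a - b ≡ (a + k * x) - (b + k * y) + (y - x) * k
    rearrange = solve-∀
    embed : ∀ a x → + a + + k * + x ≡ + (a ℕ.+ k ℕ.* x)
    embed a x = trans (cong (_+_ (+ a)) (sym (pos-* k x))) (sym (pos-+ a (k ℕ.* x)))
    both-sides : (+ a + + k * + x) - (+ b + + k * + y) ≡ + 0
    both-sides = trans (cong₂ _-_ (trans (embed a x) (cong +_ eq)) (embed b y)) (+-inverseʳ (+ (b ℕ.+ k ℕ.* y)))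

  *-mod : ∀ {a a′ b b′ k} → a ≡ a′ [mod k ] → b ≡ b′ [mod k ] → a * b ≡ a′ * b′ [mod k ]
  *-mod {a} {a′} {b} {b′} (mod a≡a′) (mod b≡b′) =
    mod (subst (_ ∣_) (split a a′ b b′) (∣m∣n⇒∣m+n (∣m⇒∣m*n b a≡a′) (∣n⇒∣m*n a′ b≡b′)))
    where
    split : ∀ a a′ b b′ → (a - a′) * b + a′ * (b - b′) ≡ a * b - a′ * b′
    split = solve-∀

  double+-mod2 : ∀ a b → a + a + b ≡ b [mod + 2 ]
  double+-mod2 a b = mod (divides a (cancel a b))
    where
    cancel : ∀ a b → a + a + b - b ≡ a * + 2
    cancel = solve-∀

  square-mod2 : ∀ x → x * x ≡ x [mod + 2 ]
  square-mod2 x with x %ℕ 2 | n%ℕd<d x 2 | a≡a%ℕn+[a/ℕn]*n x 2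
  ... | 0 | _ | x≡2q = subst (λ z → z * z ≡ z [mod + 2 ]) (sym x≡2q) (mod (divides (q * q * + 2 - q) (even-case q)))
    where
    q = x /ℕ 2
    even-case : ∀ q → (+ 0 + q * + 2) * (+ 0 + q * + 2) - (+ 0 + q * + 2) ≡ (q * q * + 2 - q) * + 2
    even-case = solve-∀
  ... | 1 | _ | x≡2q+1 = subst (λ z → z * z ≡ z [mod + 2 ]) (sym x≡2q+1) (mod (divides (q + q * q * + 2) (odd-case q)))
    where
    q = x /ℕ 2
    odd-case : ∀ q → (+ 1 + q * + 2) * (+ 1 + q * + 2) - (+ 1 + q * + 2) ≡ (q + q * q * + 2) * + 2
    odd-case = solve-∀
  ... | suc (suc _) | s≤s (s≤s ()) | _

  foldr-+-map-applyUpTo : ∀ {A : Set} (h : A → ℤ) (f : ℕ → A) n →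
    foldr _+_ (+ 0) (map h (applyUpTo f n)) ≡ ∑[ i < n ] h (f i)
  foldr-+-map-applyUpTo h f zero    = refl
  foldr-+-map-applyUpTo h f (suc n) = cong (_+_ (h (f 0))) (foldr-+-map-applyUpTo h (f ∘ suc) n)

  ∑-cong : ∀ n {h h′ : ℕ → ℤ} → (∀ i → i < n → h i ≡ h′ i) → ∑< n h ≡ ∑< n h′
  ∑-cong zero    eq = refl
  ∑-cong (suc n) eq = cong₂ _+_ (eq 0 (s≤s z≤n)) (∑-cong n (λ i i<n → eq (suc i) (s≤s i<n)))

  ∑-last : ∀ n (h : ℕ → ℤ) → ∑< (suc n) h ≡ ∑< n h + h n
  ∑-last zero    h = +-comm (h 0) (+ 0)
  ∑-last (suc n) h = trans (cong (_+_ (h 0)) (∑-last n (h ∘ suc))) (sym (+-assoc (h 0) _ _))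

  ∑-zero : ∀ n → ∑[ i < n ] + 0 ≡ + 0
  ∑-zero zero    = refl
  ∑-zero (suc n) = trans (+-identityˡ _) (∑-zero n)

  ∑-+ : ∀ n (h h′ : ℕ → ℤ) → ∑[ i < n ] (h i + h′ i) ≡ ∑< n h + ∑< n h′
  ∑-+ zero    h h′ = refl
  ∑-+ (suc n) h h′ = trans (cong (_+_ (h 0 + h′ 0)) (∑-+ n (h ∘ suc) (h′ ∘ suc))) (interchange (h 0) (h′ 0) _ _)
    where
    interchange : ∀ a b c d → a + b + (c + d) ≡ a + c + (b + d)
    interchange = solve-∀

  ∑-- : ∀ n (h h′ : ℕ → ℤ) → ∑[ i < n ] (h i - h′ i) ≡ ∑< n h - ∑< n h′
  ∑-- zero    h h′ = refl
  ∑-- (suc n) h h′ = trans (cong (_+_ (h 0 - h′ 0)) (∑-- n (h ∘ suc) (h′ ∘ suc))) (interchange (h 0) (h′ 0) _ _)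
    where
    interchange : ∀ a b c d → a - b + (c - d) ≡ a + c - (b + d)
    interchange = solve-∀

  ∑-*ˡ : ∀ n c (h : ℕ → ℤ) → ∑[ i < n ] (c * h i) ≡ c * ∑< n h
  ∑-*ˡ zero    c h = sym (*-zeroʳ c)
  ∑-*ˡ (suc n) c h = trans (cong (_+_ (c * h 0)) (∑-*ˡ n c (h ∘ suc))) (sym (*-distribˡ-+ c (h 0) _))

  ∑-split : ∀ a b (h : ℕ → ℤ) → ∑< (a ℕ.+ b) h ≡ ∑< a h + (∑[ i < b ] h (a ℕ.+ i))
  ∑-split zero    b h = sym (+-identityˡ _)
  ∑-split (suc a) b h = trans (cong (_+_ (h 0)) (∑-split a b (h ∘ suc))) (sym (+-assoc (h 0) _ _))

  ∑-reverse : ∀ n (h : ℕ → ℤ) → ∑< n h ≡ ∑[ i < n ] h (n ∸ suc i)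
  ∑-reverse zero    h = refl
  ∑-reverse (suc n) h = begin
    h 0 + ∑< n (h ∘ suc)                              ≡⟨ cong (_+_ (h 0)) (∑-reverse n (h ∘ suc)) ⟩
    h 0 + (∑[ i < n ] h (suc (n ∸ suc i)))            ≡⟨ +-comm (h 0) _ ⟩
    (∑[ i < n ] h (suc (n ∸ suc i))) + h 0            ≡⟨ cong₂ _+_ (∑-cong n (λ i i<n → cong h (sym (ℕₚ.+-∸-assoc 1 i<n))))
                                                                   (cong h (sym (ℕₚ.n∸n≡0 n))) ⟩
    (∑[ i < n ] h (suc n ∸ suc i)) + h (suc n ∸ suc n) ≡⟨ ∑-last n (λ i → h (suc n ∸ suc i)) ⟨
    ∑[ i < suc n ] h (suc n ∸ suc i)                  ∎

  ∑-swap : ∀ n k (F : ℕ → ℕ → ℤ) → ∑[ i < n ] ∑< k (F i) ≡ ∑[ j < k ] ∑[ i < n ] F i j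
  ∑-swap zero    k F = sym (∑-zero k)
  ∑-swap (suc n) k F = trans (cong (_+_ (∑< k (F 0))) (∑-swap n k (F ∘ suc))) (sym (∑-+ k (F 0) _))

  ∑-triangle : ∀ N (F : ℕ → ℕ → ℤ) →
    ∑[ k < suc N ] ∑[ i < suc k ] F i k ≡ ∑[ i < suc N ] ∑[ j < suc (N ∸ i) ] F i (i ℕ.+ j)
  ∑-triangle zero    F = refl
  ∑-triangle (suc N) F = begin
    ∑[ k < suc (suc N) ] ∑[ i < suc k ] F i k
      ≡⟨ ∑-last (suc N) (λ k → ∑[ i < suc k ] F i k) ⟩
    (∑[ k < suc N ] ∑[ i < suc k ] F i k) + (∑[ i < suc (suc N) ] F i (suc N))
      ≡⟨ cong₂ _+_ (∑-triangle N F) (∑-last (suc N) (λ i → F i (suc N))) ⟩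
    rows N + ((∑[ i < suc N ] F i (suc N)) + F (suc N) (suc N))
      ≡⟨ +-assoc (rows N) _ _ ⟨
    rows N + (∑[ i < suc N ] F i (suc N)) + F (suc N) (suc N)
      ≡⟨ cong₂ _+_ (∑-+ (suc N) (row N) (λ i → F i (suc N))) (+-identityʳ _) ⟨
    (∑[ i < suc N ] (row N i + F i (suc N))) + (F (suc N) (suc N) + + 0)
      ≡⟨ cong₂ _+_ (∑-cong (suc N) extend-row) last-row ⟩
    (∑[ i < suc N ] row (suc N) i) + row (suc N) (suc N)
      ≡⟨ ∑-last (suc N) (row (suc N)) ⟨
    rows (suc N) ∎
    where
    row : ℕ → ℕ → ℤ
    row M i = ∑[ j < suc (M ∸ i) ] F i (i ℕ.+ j)
    rows : ℕ → ℤ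
    rows M = ∑< (suc M) (row M)
    last-row : F (suc N) (suc N) + + 0 ≡ row (suc N) (suc N)
    last-row = trans (cong (λ z → F (suc N) z + + 0) (sym (ℕₚ.+-identityʳ (suc N))))
                     (cong (λ z → ∑[ j < suc z ] F (suc N) (suc N ℕ.+ j)) (sym (ℕₚ.n∸n≡0 N)))
    extend-row : ∀ i → i < suc N → row N i + F i (suc N) ≡ row (suc N) i
    extend-row i i<sN = begin
      row N i + F i (suc N)                          ≡⟨ cong (λ z → row N i + F i z) last-index ⟩
      row N i + F i (i ℕ.+ suc (N ∸ i))              ≡⟨ ∑-last (suc (N ∸ i)) (λ j → F i (i ℕ.+ j)) ⟨
      ∑[ j < suc (suc (N ∸ i)) ] F i (i ℕ.+ j)       ≡⟨ cong (λ z → ∑[ j < suc z ] F i (i ℕ.+ j)) (sym (ℕₚ.+-∸-assoc 1 i≤N)) ⟩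
      row (suc N) i                                  ∎
      where
      i≤N = ℕₚ.≤-pred i<sN
      last-index : suc N ≡ i ℕ.+ suc (N ∸ i)
      last-index = trans (cong suc (sym (ℕₚ.m+[n∸m]≡n i≤N))) (sym (ℕₚ.+-suc i (N ∸ i)))

  ∑-divisible : ∀ n {k} (h : ℕ → ℤ) → (∀ i → i < n → k ∣ h i) → k ∣ ∑< n h
  ∑-divisible zero    {k} h k∣h = divides (+ 0) refl
  ∑-divisible (suc n) {k} h k∣h =
    ∣m∣n⇒∣m+n (k∣h 0 (s≤s z≤n)) (∑-divisible n (h ∘ suc) (λ i i<n → k∣h (suc i) (s≤s i<n)))

  ∑-mod : ∀ n {k} (h h′ : ℕ → ℤ) → (∀ i → i < n → h i ≡ h′ i [mod k ]) → ∑< n h ≡ ∑< n h′ [mod k ]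
  ∑-mod n h h′ h≡h′ = mod (subst (_ ∣_) (∑-- n h h′) (∑-divisible n _ (λ i i<n → divides-difference (h≡h′ i i<n))))

  ∑-even-odd : ∀ k (h : ℕ → ℤ) →
    ∑< (k ℕ.+ k) h ≡ (∑[ j < k ] h (j ℕ.+ j)) + (∑[ j < k ] h (suc (j ℕ.+ j)))
  ∑-even-odd zero    h = refl
  ∑-even-odd (suc k) h = begin
    ∑< (suc k ℕ.+ suc k) h
      ≡⟨ cong (λ z → ∑< (suc z) h) (ℕₚ.+-suc k k) ⟩
    h 0 + (h 1 + ∑< (k ℕ.+ k) (h ∘ suc ∘ suc))
      ≡⟨ cong (λ z → h 0 + (h 1 + z)) (∑-even-odd k (h ∘ suc ∘ suc)) ⟩
    h 0 + (h 1 + ((∑[ j < k ] h (2 ℕ.+ (j ℕ.+ j))) + (∑[ j < k ] h (3 ℕ.+ (j ℕ.+ j)))))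
      ≡⟨ interchange (h 0) (h 1) _ _ ⟩
    h 0 + (∑[ j < k ] h (2 ℕ.+ (j ℕ.+ j))) + (h 1 + (∑[ j < k ] h (3 ℕ.+ (j ℕ.+ j))))
      ≡⟨ cong₂ _+_ (cong (_+_ (h 0)) (∑-cong k (λ j _ → cong (h ∘ suc) (sym (ℕₚ.+-suc j j)))))
                   (cong (_+_ (h 1)) (∑-cong k (λ j _ → cong (h ∘ suc ∘ suc) (sym (ℕₚ.+-suc j j))))) ⟩
    (∑[ j < suc k ] h (j ℕ.+ j)) + (∑[ j < suc k ] h (suc (j ℕ.+ j))) ∎
    where
    interchange : ∀ a b c d → a + (b + (c + d)) ≡ a + c + (b + d)
    interchange = solve-∀

  ∑-δ-inside : ∀ L c (g : ℕ → ℤ) → c < L → ∑[ i < L ] indicator (c ≟ i) * g i ≡ g c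
  ∑-δ-inside (suc L) zero    g _ = begin
    + 1 * g 0 + (∑[ i < L ] + 0 * g (suc i)) ≡⟨ cong₂ _+_ (*-identityˡ (g 0)) (∑-cong L (λ i _ → *-zeroˡ (g (suc i)))) ⟩
    g 0 + (∑[ i < L ] + 0)                   ≡⟨ cong (_+_ (g 0)) (∑-zero L) ⟩
    g 0 + + 0                                ≡⟨ +-identityʳ (g 0) ⟩
    g 0                                      ∎
  ∑-δ-inside (suc L) (suc c) g (s≤s c<L) =
    trans (cong₂ _+_ (*-zeroˡ (g 0)) (∑-δ-inside L c (g ∘ suc) c<L)) (+-identityˡ (g (suc c)))

  ∑-δ-outside : ∀ L c (g : ℕ → ℤ) → ¬ c < L → ∑[ i < L ] indicator (c ≟ i) * g i ≡ + 0
  ∑-δ-outside zero    c       g _    = refl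
  ∑-δ-outside (suc L) zero    g c≮L  = contradiction (s≤s z≤n) c≮L
  ∑-δ-outside (suc L) (suc c) g c≮L  =
    trans (cong₂ _+_ (*-zeroˡ (g 0)) (∑-δ-outside L c (g ∘ suc) (c≮L ∘ s≤s))) (+-identityˡ (+ 0))

  Palindromic : ℕ → (ℕ → ℤ) → Set
  Palindromic n h = ∀ i → i < n → h i ≡ h (n ∸ suc i)

  ∑-palindrome-even : ∀ k h → Palindromic (k ℕ.+ k) h → ∑< (k ℕ.+ k) h ≡ ∑< k h + ∑< k h
  ∑-palindrome-even k h pal = begin
    ∑< (k ℕ.+ k) h                         ≡⟨ ∑-split k k h ⟩
    ∑< k h + (∑[ i < k ] h (k ℕ.+ i))       ≡⟨ cong (_+_ (∑< k h)) (∑-reverse k (λ i → h (k ℕ.+ i))) ⟩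
    ∑< k h + (∑[ i < k ] h (k ℕ.+ (k ∸ suc i))) ≡⟨ cong (_+_ (∑< k h)) (∑-cong k mirror) ⟩
    ∑< k h + ∑< k h                         ∎
    where
    mirror : ∀ i → i < k → h (k ℕ.+ (k ∸ suc i)) ≡ h i
    mirror i i<k = trans (cong h (sym (ℕₚ.+-∸-assoc k i<k))) (sym (pal i (ℕₚ.<-≤-trans i<k (ℕₚ.m≤m+n k k))))

  ∑-palindrome-odd : ∀ k h → Palindromic (suc (k ℕ.+ k)) h → ∑< (suc (k ℕ.+ k)) h ≡ ∑< k h + (h k + ∑< k h)
  ∑-palindrome-odd k h pal = begin
    ∑< (suc (k ℕ.+ k)) h                               ≡⟨ cong (λ z → ∑< z h) (sym (ℕₚ.+-suc k k)) ⟩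
    ∑< (k ℕ.+ suc k) h                                 ≡⟨ ∑-split k (suc k) h ⟩
    ∑< k h + (h (k ℕ.+ 0) + (∑[ i < k ] h (k ℕ.+ suc i)))
                                                       ≡⟨ cong (λ z → ∑< k h + (h z + (∑[ i < k ] h (k ℕ.+ suc i)))) (ℕₚ.+-identityʳ k) ⟩
    ∑< k h + (h k + (∑[ i < k ] h (k ℕ.+ suc i)))        ≡⟨ cong (λ z → ∑< k h + (h k + z)) (∑-reverse k _) ⟩
    ∑< k h + (h k + (∑[ i < k ] h (k ℕ.+ suc (k ∸ suc i)))) ≡⟨ cong (λ z → ∑< k h + (h k + z)) (∑-cong k mirror) ⟩
    ∑< k h + (h k + ∑< k h)                            ∎
    where
    mirror : ∀ i → i < k → h (k ℕ.+ suc (k ∸ suc i)) ≡ h i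
    mirror i i<k = begin
      h (k ℕ.+ suc (k ∸ suc i))   ≡⟨ cong h (ℕₚ.+-suc k (k ∸ suc i)) ⟩
      h (suc (k ℕ.+ (k ∸ suc i))) ≡⟨ cong (h ∘ suc) (ℕₚ.+-∸-assoc k i<k) ⟨
      h (suc (k ℕ.+ k ∸ suc i))   ≡⟨ cong h (ℕₚ.+-∸-assoc 1 i<k+k) ⟨
      h (k ℕ.+ k ∸ i)             ≡⟨ pal i (s≤s (ℕₚ.<⇒≤ i<k+k)) ⟨
      h i                         ∎
      where
      i<k+k = ℕₚ.<-≤-trans i<k (ℕₚ.m≤m+n k k)

module PowerSeries where

  open Parity using (even-or-odd)
  open IntegerSums
  open import Data.Nat as ℕ using (ℕ; zero; suc; _∸_; _<_; _≤_)
  import Data.Nat.Properties as ℕₚ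
  open import Data.Nat.Tactic.RingSolver as ℕ-Solver using ()
  open import Data.Integer using (ℤ; +_; _+_; _*_; _-_; _^_)
  open import Data.Integer.Properties
  open import Data.Integer.Divisibility.Signed using (_∣_; divides; ∣m∣n⇒∣m+n)
  open import Data.Integer.Tactic.RingSolver using (solve-∀)
  open import Data.Product using (_,_)
  open import Data.Sum using (inj₁; inj₂)
  open ≡-Reasoning

  one : Series
  one zero    = + 1
  one (suc _) = + 0

  infixr 7.5 _·_
  _·_ : ℤ → Series → Series
  (c · f) N = c * f N

  infix 4 _≋_[mod_]
  _≋_[mod_] : Series → Series → ℤ → Set
  f ≋ g [mod k ] = ∀ N → f N ≡ g N [mod k ]

  ⊛-as-∑ : ∀ f g N → (f ⊛ g) N ≡ ∑[ i < suc N ] f i * g (N ∸ i)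
  ⊛-as-∑ f g N = foldr-+-map-applyUpTo (λ i → f i * g (N ∸ i)) (λ i → i) (suc N)

  ⊛-cong : ∀ {f f′ g g′} → f ≗ f′ → g ≗ g′ → f ⊛ g ≗ f′ ⊛ g′
  ⊛-cong {f} {f′} {g} {g′} f≗f′ g≗g′ N = begin
    (f ⊛ g) N                          ≡⟨ ⊛-as-∑ f g N ⟩
    ∑[ i < suc N ] f i * g (N ∸ i)     ≡⟨ ∑-cong (suc N) (λ i _ → cong₂ _*_ (f≗f′ i) (g≗g′ (N ∸ i))) ⟩
    ∑[ i < suc N ] f′ i * g′ (N ∸ i)   ≡⟨ ⊛-as-∑ f′ g′ N ⟨
    (f′ ⊛ g′) N                        ∎

  ⊛-congˡ : ∀ f {g g′} → g ≗ g′ → f ⊛ g ≗ f ⊛ g′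
  ⊛-congˡ f = ⊛-cong {f} {f} (λ _ → refl)

  ⊛-congʳ : ∀ g {f f′} → f ≗ f′ → f ⊛ g ≗ f′ ⊛ g
  ⊛-congʳ g f≗f′ = ⊛-cong {g = g} {g′ = g} f≗f′ (λ _ → refl)

  ⊛-identityˡ : ∀ f → one ⊛ f ≗ f
  ⊛-identityˡ f N = begin
    (one ⊛ f) N                                  ≡⟨ ⊛-as-∑ one f N ⟩
    + 1 * f N + (∑[ i < N ] + 0 * f (N ∸ suc i))  ≡⟨ cong₂ _+_ (*-identityˡ (f N)) (∑-cong N (λ i _ → *-zeroˡ (f (N ∸ suc i)))) ⟩
    f N + (∑[ i < N ] + 0)                        ≡⟨ cong (_+_ (f N)) (∑-zero N) ⟩
    f N + + 0                                     ≡⟨ +-identityʳ (f N) ⟩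
    f N                                           ∎

  ⊛-comm : ∀ f g → f ⊛ g ≗ g ⊛ f
  ⊛-comm f g N = begin
    (f ⊛ g) N                                    ≡⟨ ⊛-as-∑ f g N ⟩
    ∑[ i < suc N ] f i * g (N ∸ i)               ≡⟨ ∑-reverse (suc N) (λ i → f i * g (N ∸ i)) ⟩
    ∑[ i < suc N ] f (N ∸ i) * g (N ∸ (N ∸ i))   ≡⟨ ∑-cong (suc N) swap-factors ⟩
    ∑[ i < suc N ] g i * f (N ∸ i)               ≡⟨ ⊛-as-∑ g f N ⟨
    (g ⊛ f) N                                    ∎
    where
    swap-factors : ∀ i → i < suc N → f (N ∸ i) * g (N ∸ (N ∸ i)) ≡ g i * f (N ∸ i)
    swap-factors i i<sN = trans (cong (λ j → f (N ∸ i) * g j) (ℕₚ.m∸[m∸n]≡n (ℕₚ.≤-pred i<sN))) (*-comm (f (N ∸ i)) (g i))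

  ⊛-identityʳ : ∀ f → f ⊛ one ≗ f
  ⊛-identityʳ f N = trans (⊛-comm f one N) (⊛-identityˡ f N)

  ⊛-assoc : ∀ f g h → (f ⊛ g) ⊛ h ≗ f ⊛ (g ⊛ h)
  ⊛-assoc f g h N = begin
    ((f ⊛ g) ⊛ h) N
      ≡⟨ ⊛-as-∑ (f ⊛ g) h N ⟩
    ∑[ k < suc N ] (f ⊛ g) k * h (N ∸ k)
      ≡⟨ ∑-cong (suc N) (λ k _ → expand-left k) ⟩
    ∑[ k < suc N ] ∑[ i < suc k ] h (N ∸ k) * (f i * g (k ∸ i))
      ≡⟨ ∑-triangle N (λ i k → h (N ∸ k) * (f i * g (k ∸ i))) ⟩
    ∑[ i < suc N ] ∑[ j < suc (N ∸ i) ] h (N ∸ (i ℕ.+ j)) * (f i * g (i ℕ.+ j ∸ i))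
      ≡⟨ ∑-cong (suc N) (λ i _ → collect-right i) ⟩
    ∑[ i < suc N ] f i * (g ⊛ h) (N ∸ i)
      ≡⟨ ⊛-as-∑ f (g ⊛ h) N ⟨
    (f ⊛ (g ⊛ h)) N ∎
    where
    rotate : ∀ a b c → a * (b * c) ≡ b * (c * a)
    rotate = solve-∀
    expand-left : ∀ k → (f ⊛ g) k * h (N ∸ k) ≡ ∑[ i < suc k ] h (N ∸ k) * (f i * g (k ∸ i))
    expand-left k = begin
      (f ⊛ g) k * h (N ∸ k)                         ≡⟨ cong (_* h (N ∸ k)) (⊛-as-∑ f g k) ⟩
      (∑[ i < suc k ] f i * g (k ∸ i)) * h (N ∸ k)   ≡⟨ *-comm _ (h (N ∸ k)) ⟩
      h (N ∸ k) * (∑[ i < suc k ] f i * g (k ∸ i))   ≡⟨ ∑-*ˡ (suc k) (h (N ∸ k)) (λ i → f i * g (k ∸ i)) ⟨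
      ∑[ i < suc k ] h (N ∸ k) * (f i * g (k ∸ i))   ∎
    collect-right : ∀ i → ∑[ j < suc (N ∸ i) ] h (N ∸ (i ℕ.+ j)) * (f i * g (i ℕ.+ j ∸ i)) ≡ f i * (g ⊛ h) (N ∸ i)
    collect-right i = begin
      ∑[ j < suc (N ∸ i) ] h (N ∸ (i ℕ.+ j)) * (f i * g (i ℕ.+ j ∸ i))
        ≡⟨ ∑-cong (suc (N ∸ i)) (λ j _ → trans (cong₂ (λ a b → h a * (f i * g b)) (sym (ℕₚ.∸-+-assoc N i j)) (ℕₚ.m+n∸m≡n i j))
                                               (rotate (h (N ∸ i ∸ j)) (f i) (g j))) ⟩
      ∑[ j < suc (N ∸ i) ] f i * (g j * h (N ∸ i ∸ j))
        ≡⟨ ∑-*ˡ (suc (N ∸ i)) (f i) (λ j → g j * h (N ∸ i ∸ j)) ⟩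
      f i * (∑[ j < suc (N ∸ i) ] g j * h (N ∸ i ∸ j))
        ≡⟨ cong (f i *_) (⊛-as-∑ g h (N ∸ i)) ⟨
      f i * (g ⊛ h) (N ∸ i) ∎

  ⊛-·ˡ : ∀ c f g → c · f ⊛ g ≗ c · (f ⊛ g)
  ⊛-·ˡ c f g N = begin
    (c · f ⊛ g) N                            ≡⟨ ⊛-as-∑ (c · f) g N ⟩
    ∑[ i < suc N ] c * f i * g (N ∸ i)       ≡⟨ ∑-cong (suc N) (λ i _ → *-assoc c (f i) (g (N ∸ i))) ⟩
    ∑[ i < suc N ] c * (f i * g (N ∸ i))     ≡⟨ ∑-*ˡ (suc N) c (λ i → f i * g (N ∸ i)) ⟩
    c * (∑[ i < suc N ] f i * g (N ∸ i))     ≡⟨ cong (c *_) (⊛-as-∑ f g N) ⟨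
    (c · (f ⊛ g)) N                          ∎

  ⊛-·ʳ : ∀ c f g → f ⊛ c · g ≗ c · (f ⊛ g)
  ⊛-·ʳ c f g N = begin
    (f ⊛ c · g) N     ≡⟨ ⊛-comm f (c · g) N ⟩
    (c · g ⊛ f) N     ≡⟨ ⊛-·ˡ c g f N ⟩
    c * (g ⊛ f) N     ≡⟨ cong (c *_) (⊛-comm g f N) ⟩
    (c · (f ⊛ g)) N   ∎

  pow-zero : ∀ f → pow f 0 ≗ one
  pow-zero f zero    = refl
  pow-zero f (suc N) = refl

  pow-cong : ∀ {f g} n → f ≗ g → pow f n ≗ pow g n
  pow-cong {f} {g} zero f≗g N = trans (pow-zero f N) (sym (pow-zero g N))
  pow-cong (suc n) f≗g = ⊛-cong f≗g (pow-cong n f≗g)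

  pow-+ : ∀ f m n → pow f (m ℕ.+ n) ≗ pow f m ⊛ pow f n
  pow-+ f zero    n N = sym (trans (⊛-congʳ (pow f n) (pow-zero f) N) (⊛-identityˡ (pow f n) N))
  pow-+ f (suc m) n N = trans (⊛-congˡ f (pow-+ f m n) N) (sym (⊛-assoc f (pow f m) (pow f n) N))

  pow-two : ∀ f → pow f 2 ≗ f ⊛ f
  pow-two f = ⊛-congˡ f (λ N → trans (⊛-congˡ f (pow-zero f) N) (⊛-identityʳ f N))

  pow-· : ∀ c f n → pow (c · f) n ≗ (c ^ n) · pow f n
  pow-· c f zero    zero    = refl
  pow-· c f zero    (suc N) = refl
  pow-· c f (suc n) N = begin
    (c · f ⊛ pow (c · f) n) N           ≡⟨ ⊛-congˡ (c · f) (pow-· c f n) N ⟩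
    (c · f ⊛ (c ^ n) · pow f n) N       ≡⟨ ⊛-·ˡ c f ((c ^ n) · pow f n) N ⟩
    c * (f ⊛ (c ^ n) · pow f n) N       ≡⟨ cong (c *_) (⊛-·ʳ (c ^ n) f (pow f n) N) ⟩
    c * (c ^ n * pow f (suc n) N)       ≡⟨ *-assoc c (c ^ n) _ ⟨
    ((c ^ suc n) · pow f (suc n)) N     ∎

  ≗⇒≋ : ∀ {f g k} → f ≗ g → f ≋ g [mod k ]
  ≗⇒≋ f≗g N = ≡⇒≡-mod (f≗g N)

  ≋-refl : ∀ f {k} → f ≋ f [mod k ]
  ≋-refl f = ≗⇒≋ {f} (λ _ → refl)

  ≋-trans : ∀ {f g h k} → f ≋ g [mod k ] → g ≋ h [mod k ] → f ≋ h [mod k ]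
  ≋-trans f≡g g≡h N = mod-trans (f≡g N) (g≡h N)

  ⊛-≋ : ∀ {f f′ g g′ k} → f ≋ f′ [mod k ] → g ≋ g′ [mod k ] → f ⊛ g ≋ f′ ⊛ g′ [mod k ]
  ⊛-≋ {f} {f′} {g} {g′} f≡f′ g≡g′ N =
    subst₂ (_≡_[mod _ ]) (sym (⊛-as-∑ f g N)) (sym (⊛-as-∑ f′ g′ N))
      (∑-mod (suc N) _ _ (λ i _ → *-mod (f≡f′ i) (g≡g′ (N ∸ i))))

  -- (f ⊛ f) - (g ⊛ g) = (f - g) ⊛ (f + g), and both factors are even.
  square-≋ : ∀ {f g} → f ≋ g [mod + 2 ] → f ⊛ f ≋ g ⊛ g [mod + 4 ]
  square-≋ {f} {g} f≡g N = mod (subst (+ 4 ∣_) difference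
    (∑-divisible (suc N) _ (λ i _ → even*even (divides-difference (f≡g i)) (sum-even (N ∸ i)))))
    where
    even*even : ∀ {a b} → + 2 ∣ a → + 2 ∣ b → + 4 ∣ a * b
    even*even (divides p refl) (divides q refl) = divides (p * q) (regroup p q)
      where
      regroup : ∀ p q → p * + 2 * (q * + 2) ≡ p * q * + 4
      regroup = solve-∀
    sum-even : ∀ j → + 2 ∣ f j + g j
    sum-even j = subst (+ 2 ∣_) (regroup (f j) (g j)) (∣m∣n⇒∣m+n (divides-difference (f≡g j)) (divides (g j) refl))
      where
      regroup : ∀ a b → a - b + b * + 2 ≡ a + b
      regroup = solve-∀
    expand : ∀ a b c d → (a - b) * (c + d) ≡ (a * c - b * d) + (a * d - b * c)
    expand = solve-∀
    cross-terms : (∑[ i < suc N ] f i * g (N ∸ i)) - (∑[ i < suc N ] g i * f (N ∸ i)) ≡ + 0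
    cross-terms = begin
      (∑[ i < suc N ] f i * g (N ∸ i)) - (∑[ i < suc N ] g i * f (N ∸ i)) ≡⟨ cong₂ _-_ (⊛-as-∑ f g N) (⊛-as-∑ g f N) ⟨
      (f ⊛ g) N - (g ⊛ f) N                                               ≡⟨ cong (_-_ ((f ⊛ g) N)) (⊛-comm f g N) ⟨
      (f ⊛ g) N - (f ⊛ g) N                                               ≡⟨ +-inverseʳ ((f ⊛ g) N) ⟩
      + 0                                                                 ∎
    difference : ∑[ i < suc N ] (f i - g i) * (f (N ∸ i) + g (N ∸ i)) ≡ (f ⊛ f) N - (g ⊛ g) N
    difference = begin
      ∑[ i < suc N ] (f i - g i) * (f (N ∸ i) + g (N ∸ i))
        ≡⟨ ∑-cong (suc N) (λ i _ → expand (f i) (g i) (f (N ∸ i)) (g (N ∸ i))) ⟩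
      ∑[ i < suc N ] ((f i * f (N ∸ i) - g i * g (N ∸ i)) + (f i * g (N ∸ i) - g i * f (N ∸ i)))
        ≡⟨ ∑-+ (suc N) (λ i → f i * f (N ∸ i) - g i * g (N ∸ i)) (λ i → f i * g (N ∸ i) - g i * f (N ∸ i)) ⟩
      (∑[ i < suc N ] (f i * f (N ∸ i) - g i * g (N ∸ i))) + (∑[ i < suc N ] (f i * g (N ∸ i) - g i * f (N ∸ i)))
        ≡⟨ cong₂ _+_ (∑-- (suc N) (λ i → f i * f (N ∸ i)) (λ i → g i * g (N ∸ i)))
                     (trans (∑-- (suc N) (λ i → f i * g (N ∸ i)) (λ i → g i * f (N ∸ i))) cross-terms) ⟩
      (∑[ i < suc N ] f i * f (N ∸ i)) - (∑[ i < suc N ] g i * g (N ∸ i)) + + 0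
        ≡⟨ +-identityʳ _ ⟩
      (∑[ i < suc N ] f i * f (N ∸ i)) - (∑[ i < suc N ] g i * g (N ∸ i))
        ≡⟨ cong₂ _-_ (⊛-as-∑ f f N) (⊛-as-∑ g g N) ⟨
      (f ⊛ f) N - (g ⊛ g) N
        ∎

  dilate : Series → Series
  dilate f zero          = f 0
  dilate f (suc zero)    = + 0
  dilate f (suc (suc N)) = dilate (f ∘ suc) N

  dilate-even : ∀ f k → dilate f (k ℕ.+ k) ≡ f k
  dilate-even f zero    = refl
  dilate-even f (suc k) = trans (cong (dilate f ∘ suc) (ℕₚ.+-suc k k)) (dilate-even (f ∘ suc) k)

  dilate-odd : ∀ f k → dilate f (suc (k ℕ.+ k)) ≡ + 0
  dilate-odd f zero    = refl
  dilate-odd f (suc k) = trans (cong (dilate f ∘ suc ∘ suc) (ℕₚ.+-suc k k)) (dilate-odd (f ∘ suc) k)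

  ⊛-self-palindromic : ∀ (f : Series) N → Palindromic (suc N) (λ i → f i * f (N ∸ i))
  ⊛-self-palindromic f N i i<sN =
    trans (*-comm (f i) (f (N ∸ i))) (cong (λ j → f (N ∸ i) * f j) (sym (ℕₚ.m∸[m∸n]≡n (ℕₚ.≤-pred i<sN))))

  -- Over ℤ/2 squaring is additive on coefficients, so (∑ aₙ tⁿ)² ≡ ∑ aₙ² t²ⁿ ≡ ∑ aₙ t²ⁿ.
  ⊛-self≋dilate : ∀ f → f ⊛ f ≋ dilate f [mod + 2 ]
  ⊛-self≋dilate f N with even-or-odd N
  ... | inj₁ (k , refl) = subst₂ (_≡_[mod + 2 ]) (sym at-even) (sym (dilate-even f k))
                                 (mod-trans (double+-mod2 (∑< k h) (f k * f k)) (square-mod2 (f k)))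
    where
    h : ℕ → ℤ
    h i = f i * f (k ℕ.+ k ∸ i)
    at-even : (f ⊛ f) (k ℕ.+ k) ≡ ∑< k h + ∑< k h + f k * f k
    at-even = begin
      (f ⊛ f) (k ℕ.+ k)                ≡⟨ ⊛-as-∑ f f (k ℕ.+ k) ⟩
      ∑< (suc (k ℕ.+ k)) h             ≡⟨ ∑-palindrome-odd k h (⊛-self-palindromic f (k ℕ.+ k)) ⟩
      ∑< k h + (h k + ∑< k h)           ≡⟨ cong (λ j → ∑< k h + (f k * f j + ∑< k h)) (ℕₚ.m+n∸m≡n k k) ⟩
      ∑< k h + (f k * f k + ∑< k h)     ≡⟨ rearrange (∑< k h) (f k * f k) ⟩
      ∑< k h + ∑< k h + f k * f k       ∎
      where
      rearrange : ∀ a b → a + (b + a) ≡ a + a + b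
      rearrange = solve-∀
  ... | inj₂ (k , refl) = subst₂ (_≡_[mod + 2 ]) (sym at-odd) (sym (dilate-odd f k)) (double+-mod2 (∑< (suc k) h) (+ 0))
    where
    h : ℕ → ℤ
    h i = f i * f (suc (k ℕ.+ k) ∸ i)
    length : suc (suc (k ℕ.+ k)) ≡ suc k ℕ.+ suc k
    length = cong suc (sym (ℕₚ.+-suc k k))
    palindromic : Palindromic (suc k ℕ.+ suc k) h
    palindromic = subst (λ n → Palindromic n h) length (⊛-self-palindromic f (suc (k ℕ.+ k)))
    at-odd : (f ⊛ f) (suc (k ℕ.+ k)) ≡ ∑< (suc k) h + ∑< (suc k) h + + 0
    at-odd = begin
      (f ⊛ f) (suc (k ℕ.+ k))          ≡⟨ ⊛-as-∑ f f (suc (k ℕ.+ k)) ⟩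
      ∑< (suc (suc (k ℕ.+ k))) h       ≡⟨ cong (λ n → ∑< n h) length ⟩
      ∑< (suc k ℕ.+ suc k) h           ≡⟨ ∑-palindrome-even (suc k) h palindromic ⟩
      ∑< (suc k) h + ∑< (suc k) h       ≡⟨ +-identityʳ _ ⟨
      ∑< (suc k) h + ∑< (suc k) h + + 0 ∎

  dilate-⊛ : ∀ f g n → (dilate f ⊛ dilate g) (n ℕ.+ n) ≡ (f ⊛ g) n
  dilate-⊛ f g n = begin
    (dilate f ⊛ dilate g) (n ℕ.+ n)
      ≡⟨ ⊛-as-∑ (dilate f) (dilate g) (n ℕ.+ n) ⟩
    ∑< (suc (n ℕ.+ n)) h
      ≡⟨ ∑-last (n ℕ.+ n) h ⟩
    ∑< (n ℕ.+ n) h + h (n ℕ.+ n)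
      ≡⟨ cong (_+ h (n ℕ.+ n)) (∑-even-odd n h) ⟩
    (∑[ j < n ] h (j ℕ.+ j)) + (∑[ j < n ] h (suc (j ℕ.+ j))) + h (n ℕ.+ n)
      ≡⟨ cong₂ _+_ (cong₂ _+_ (∑-cong n (λ j j<n → at-even j (ℕₚ.<⇒≤ j<n))) (trans (∑-cong n (λ j _ → at-odd j)) (∑-zero n)))
                   (at-even n ℕₚ.≤-refl) ⟩
    (∑[ j < n ] f j * g (n ∸ j)) + + 0 + f n * g (n ∸ n)
      ≡⟨ cong (_+ f n * g (n ∸ n)) (+-identityʳ (∑[ j < n ] f j * g (n ∸ j))) ⟩
    (∑[ j < n ] f j * g (n ∸ j)) + f n * g (n ∸ n)
      ≡⟨ ∑-last n (λ j → f j * g (n ∸ j)) ⟨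
    ∑[ j < suc n ] f j * g (n ∸ j)
      ≡⟨ ⊛-as-∑ f g n ⟨
    (f ⊛ g) n ∎
    where
    h : ℕ → ℤ
    h i = dilate f i * dilate g (n ℕ.+ n ∸ i)
    at-odd : ∀ j → h (suc (j ℕ.+ j)) ≡ + 0
    at-odd j = trans (cong (_* dilate g (n ℕ.+ n ∸ suc (j ℕ.+ j))) (dilate-odd f j)) (*-zeroˡ (dilate g (n ℕ.+ n ∸ suc (j ℕ.+ j))))
    at-even : ∀ j → j ℕ.≤ n → h (j ℕ.+ j) ≡ f j * g (n ∸ j)
    at-even j j≤n = cong₂ _*_ (dilate-even f j) (trans (cong (dilate g) remaining) (dilate-even g (n ∸ j)))
      where
      regroup : ∀ a b → (a ℕ.+ b) ℕ.+ (a ℕ.+ b) ≡ (a ℕ.+ a) ℕ.+ (b ℕ.+ b)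
      regroup = ℕ-Solver.solve-∀
      remaining : n ℕ.+ n ∸ (j ℕ.+ j) ≡ (n ∸ j) ℕ.+ (n ∸ j)
      remaining = begin
        n ℕ.+ n ∸ (j ℕ.+ j)                               ≡⟨ cong (λ z → z ℕ.+ z ∸ (j ℕ.+ j)) (ℕₚ.m+[n∸m]≡n j≤n) ⟨
        (j ℕ.+ (n ∸ j)) ℕ.+ (j ℕ.+ (n ∸ j)) ∸ (j ℕ.+ j)   ≡⟨ cong (_∸ (j ℕ.+ j)) (regroup j (n ∸ j)) ⟩
        (j ℕ.+ j) ℕ.+ ((n ∸ j) ℕ.+ (n ∸ j)) ∸ (j ℕ.+ j)   ≡⟨ ℕₚ.m+n∸m≡n (j ℕ.+ j) _ ⟩
        (n ∸ j) ℕ.+ (n ∸ j)                               ∎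

  pow-two≋one : ∀ {f} → f ≋ one [mod + 2 ] → pow f 2 ≋ one [mod + 4 ]
  pow-two≋one {f} f≡1 = ≋-trans (≗⇒≋ (pow-two f)) (≋-trans (square-≋ f≡1) (≗⇒≋ (⊛-identityˡ one)))

  pow-four≋one : ∀ {f} → f ≋ one [mod + 2 ] → pow f 4 ≋ one [mod + 4 ]
  pow-four≋one {f} f≡1 =
    ≋-trans (≗⇒≋ (pow-+ f 2 2)) (≋-trans (⊛-≋ (pow-two≋one f≡1) (pow-two≋one f≡1)) (≗⇒≋ (⊛-identityˡ one)))

  pow-four-even : ∀ f n → pow f 4 (n ℕ.+ n) ≡ (f ⊛ f) n [mod + 4 ]
  pow-four-even f n = mod-trans (≋-trans (≗⇒≋ (pow-+ f 2 2)) (square-≋ pow-two≋dilate) (n ℕ.+ n)) (≡⇒≡-mod (dilate-⊛ f f n))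
    where
    pow-two≋dilate : pow f 2 ≋ dilate f [mod + 2 ]
    pow-two≋dilate = ≋-trans (≗⇒≋ (pow-two f)) (⊛-self≋dilate f)

module FiniteCounting where

  open IntegerSums using (∑<; ∑-cong; indicator; foldr-+-map-applyUpTo; _≡_[mod_]; mod; divides-difference)
  open import Data.Nat as ℕ using (ℕ; _+_; _*_; _<_)
  import Data.Nat.Properties as ℕₚ
  open import Data.Nat.Tactic.RingSolver using (solve-∀)
  open import Data.Nat.ListAction using (sum)
  open import Data.Nat.ListAction.Properties using (sum-↭)
  open import Data.List using (List; []; _∷_; _++_; map; filter; foldr; upTo; cartesianProduct; length)
  open import Data.List.Properties using (map-∘; filter-all; length-upTo)
  open import Data.List.Membership.Propositional using (_∈_)
  open import Data.List.Membership.Propositional.Properties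
    using (∈-map⁺; ∈-map⁻; ∈-filter⁺; ∈-filter⁻; ∈-upTo⁺; ∈-upTo⁻; ∈-cartesianProduct⁺)
  open import Data.List.Membership.Propositional.Properties.WithK using (unique∧set⇒bag)
  open import Data.List.Relation.Unary.Unique.Propositional using (Unique)
  open import Data.List.Relation.Unary.Unique.Propositional.Properties using (filter⁺; upTo⁺; cartesianProduct⁺)
  open import Data.List.Relation.Unary.AllPairs using ([]; _∷_)
  open import Data.List.Relation.Unary.All as All using ([])
  open import Data.List.Relation.Unary.All.Properties as All using ()
  open import Data.List.Relation.Unary.Any using (here; there)
  open import Data.List.Relation.Binary.BagAndSetEquality using (∼bag⇒↭)
  import Data.List.Relation.Binary.Permutation.Propositional.Properties as Perm
  open import Data.Integer as ℤ using (ℤ; +_)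
  import Data.Integer.Properties as ℤₚ
  open import Data.Integer.Divisibility.Signed using (_∣_; divides; ∣m∣n⇒∣m+n)
  import Data.Integer.Tactic.RingSolver as ℤ-Solver
  open import Data.Product using (_×_; _,_; proj₁; proj₂)
  open import Data.Product.Relation.Binary.Lex.Strict using (×-Lex; ×-compare)
  open import Data.Product.Relation.Binary.Pointwise.NonDependent using (≡×≡⇒≡; ≡⇒≡×≡)
  open import Data.Sum using (inj₁; inj₂)
  open import Data.Empty using (⊥-elim)
  open import Relation.Nullary using (yes; no; ¬_)
  open import Relation.Unary using (Decidable)
  open import Relation.Unary.Properties using (_∩?_; ∁?)
  open import Relation.Binary.Definitions using (Trichotomous; tri<; tri≈; tri>)
  open import Relation.Binary.Consequences using (tri⇒irr; tri⇒asym; tri⇒dec≈; tri⇒dec<)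
  open import Function using (mk⇔)
  open ≡-Reasoning

  sumWhere : {A : Set} {P : A → Set} → Decidable P → (A → ℕ) → List A → ℕ
  sumWhere P? w xs = sum (map w (filter P? xs))

  map-unique : {A B : Set} (f : A → B) (xs : List A) → Unique xs →
    (∀ {a b} → a ∈ xs → b ∈ xs → f a ≡ f b → a ≡ b) → Unique (map f xs)
  map-unique f []       _              _      = []
  map-unique f (a ∷ as) (a∉as ∷ as-u) f-inj =
    All.map⁺ (All.tabulate (λ {b} b∈as fa≡fb → All.lookup a∉as b∈as (f-inj (here refl) (there b∈as) fa≡fb)))
    ∷ map-unique f as as-u (λ a∈ b∈ → f-inj (there a∈) (there b∈))

  module _ {A B : Set} {P : A → Set} {Q : B → Set} (P? : Decidable P) (Q? : Decidable Q)
           (xs : List A) (ys : List B) (xs-unique : Unique xs) (ys-unique : Unique ys)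
           (P⊆xs : ∀ {x} → P x → x ∈ xs) (Q⊆ys : ∀ {y} → Q y → y ∈ ys)
           (f : A → B) (g : B → A)
           (f-maps : ∀ {x} → P x → Q (f x)) (g-maps : ∀ {y} → Q y → P (g y))
           (g∘f : ∀ {x} → P x → g (f x) ≡ x) (f∘g : ∀ {y} → Q y → f (g y) ≡ y) where

    private
      P-holds : ∀ {x} → x ∈ filter P? xs → P x
      P-holds x∈ = proj₂ (∈-filter⁻ P? {xs = xs} x∈)

      Q-holds : ∀ {y} → y ∈ filter Q? ys → Q y
      Q-holds y∈ = proj₂ (∈-filter⁻ Q? {xs = ys} y∈)

      image-unique : Unique (map f (filter P? xs))
      image-unique = map-unique f (filter P? xs) (filter⁺ P? xs-unique)
        (λ a∈ b∈ fa≡fb → trans (sym (g∘f (P-holds a∈))) (trans (cong g fa≡fb) (g∘f (P-holds b∈))))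

      to : ∀ {y} → y ∈ map f (filter P? xs) → y ∈ filter Q? ys
      to y∈ with ∈-map⁻ f y∈
      ... | x , x∈ , refl = ∈-filter⁺ Q? (Q⊆ys (f-maps (P-holds x∈))) (f-maps (P-holds x∈))

      from : ∀ {y} → y ∈ filter Q? ys → y ∈ map f (filter P? xs)
      from y∈ = let qy = Q-holds y∈ in
        subst (_∈ map f (filter P? xs)) (f∘g qy) (∈-map⁺ f (∈-filter⁺ P? (P⊆xs (g-maps qy)) (g-maps qy)))

    sumWhere-bijection : (w : B → ℕ) → sumWhere Q? w ys ≡ sumWhere P? (w ∘ f) xs
    sumWhere-bijection w = begin
      sum (map w (filter Q? ys))                ≡⟨ sum-↭ (Perm.map⁺ w image↭filter) ⟨
      sum (map w (map f (filter P? xs)))        ≡⟨ cong sum (map-∘ (filter P? xs)) ⟨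
      sum (map (w ∘ f) (filter P? xs))          ∎
      where
      image↭filter = ∼bag⇒↭ (unique∧set⇒bag image-unique (filter⁺ Q? ys-unique) (mk⇔ to from))

  module _ {A : Set} where

    sumWhere-split : {P R : A → Set} (P? : Decidable P) (R? : Decidable R) (w : A → ℕ) (xs : List A) →
      sumWhere P? w xs ≡ sumWhere (P? ∩? R?) w xs + sumWhere (P? ∩? ∁? R?) w xs
    sumWhere-split P? R? w [] = refl
    sumWhere-split P? R? w (x ∷ xs) with P? x | R? x
    ... | no _  | _     = sumWhere-split P? R? w xs
    ... | yes _ | yes _ = trans (cong (_+_ (w x)) (sumWhere-split P? R? w xs)) (sym (ℕₚ.+-assoc (w x) _ _))
    ... | yes _ | no _  = trans (cong (_+_ (w x)) (sumWhere-split P? R? w xs)) (left-comm (w x) (sumWhere (P? ∩? R?) w xs) _)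
      where
      left-comm : ∀ a b c → a + (b + c) ≡ b + (a + c)
      left-comm = solve-∀

    sumWhere-cong : {P P′ : A → Set} (P? : Decidable P) (P′? : Decidable P′) (w : A → ℕ) (xs : List A) →
      (∀ {x} → P x → P′ x) → (∀ {x} → P′ x → P x) → sumWhere P? w xs ≡ sumWhere P′? w xs
    sumWhere-cong P? P′? w [] _ _ = refl
    sumWhere-cong P? P′? w (x ∷ xs) to from with P? x | P′? x
    ... | yes _ | yes _  = cong (_+_ (w x)) (sumWhere-cong P? P′? w xs to from)
    ... | no _  | no _   = sumWhere-cong P? P′? w xs to from
    ... | yes p | no ¬p′ = ⊥-elim (¬p′ (to p))
    ... | no ¬p | yes p′ = ⊥-elim (¬p (from p′))

    sumWhere-empty : {P : A → Set} (P? : Decidable P) (w : A → ℕ) (xs : List A) →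
      (∀ {x} → ¬ P x) → sumWhere P? w xs ≡ 0
    sumWhere-empty P? w [] _ = refl
    sumWhere-empty P? w (x ∷ xs) ¬P with P? x
    ... | yes p = ⊥-elim (¬P p)
    ... | no _  = sumWhere-empty P? w xs ¬P

    sumWhere-+ : {P : A → Set} (P? : Decidable P) (w v : A → ℕ) (xs : List A) →
      sumWhere P? (λ x → w x + v x) xs ≡ sumWhere P? w xs + sumWhere P? v xs
    sumWhere-+ P? w v [] = refl
    sumWhere-+ P? w v (x ∷ xs) with P? x
    ... | no _  = sumWhere-+ P? w v xs
    ... | yes _ = trans (cong (_+_ (w x + v x)) (sumWhere-+ P? w v xs)) (interchange (w x) (v x) _ _)
      where
      interchange : ∀ a b c d → a + b + (c + d) ≡ a + c + (b + d)
      interchange = solve-∀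

    sumWhere-*ˡ : {P : A → Set} (P? : Decidable P) (c : ℕ) (w : A → ℕ) (xs : List A) →
      sumWhere P? (λ x → c * w x) xs ≡ c * sumWhere P? w xs
    sumWhere-*ˡ P? c w [] = sym (ℕₚ.*-zeroʳ c)
    sumWhere-*ˡ P? c w (x ∷ xs) with P? x
    ... | yes _ = trans (cong (_+_ (c * w x)) (sumWhere-*ˡ P? c w xs)) (sym (ℕₚ.*-distribˡ-+ c (w x) _))
    ... | no _  = sumWhere-*ˡ P? c w xs

    sumWhere-singleton : {P : A → Set} (P? : Decidable P) (w : A → ℕ) (xs : List A) → Unique xs →
      (c : A) → c ∈ xs → P c → (∀ {x} → P x → x ≡ c) → sumWhere P? w xs ≡ w c
    sumWhere-singleton {P} P? w xs xs-unique c c∈xs pc P⇒≡c =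
      trans (sumWhere-bijection (ℕ._≟ 0) P? (0 ∷ []) xs ([] ∷ []) xs-unique
                                (λ { refl → here refl }) (λ p → subst (_∈ xs) (sym (P⇒≡c p)) c∈xs)
                                (λ _ → c) (λ _ → 0) (λ _ → pc) (λ _ → refl) (λ { refl → refl }) (sym ∘ P⇒≡c) w)
            (ℕₚ.+-identityʳ (w c))

  lex-compare : {A B : Set} {_<₁_ : A → A → Set} {_<₂_ : B → B → Set} →
    Trichotomous _≡_ _<₁_ → Trichotomous _≡_ _<₂_ → Trichotomous _≡_ (×-Lex _≡_ _<₁_ _<₂_)
  lex-compare compare₁ compare₂ p q with ×-compare sym compare₁ compare₂ p q
  ... | tri< p<q p≢q p≯q = tri< p<q (p≢q ∘ ≡⇒≡×≡) p≯q
  ... | tri≈ p≮q p≡q p≯q = tri≈ p≮q (≡×≡⇒≡ p≡q) p≯q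
  ... | tri> p≮q p≢q p>q = tri> p≮q (p≢q ∘ ≡⇒≡×≡) p>q

  -- The strict total order picks one representative from each two-element orbit {x , σ x}.
  module Involution {A : Set} {_≺_ : A → A → Set} (compare : Trichotomous _≡_ _≺_)
                    {P : A → Set} (P? : Decidable P) (σ : A → A)
                    (σ-closed : ∀ {x} → P x → P (σ x)) (σ-involutive : ∀ {x} → P x → σ (σ x) ≡ x)
                    (xs : List A) (xs-unique : Unique xs) (P⊆xs : ∀ {x} → P x → x ∈ xs) where

    Fixed : A → Set
    Fixed x = σ x ≡ x

    Fixed? : Decidable Fixed
    Fixed? x = tri⇒dec≈ compare (σ x) x

    Lower : A → Set
    Lower x = x ≺ σ x

    Lower? : Decidable Lower
    Lower? x = tri⇒dec< compare x (σ x)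

    private
      Upper : A → Set
      Upper x = σ x ≺ x

      Upper? : Decidable Upper
      Upper? x = tri⇒dec< compare (σ x) x

      non-fixed : ∀ {x} → ¬ Fixed x → ¬ Lower x → Upper x
      non-fixed {x} ¬fixed ¬lower with compare x (σ x)
      ... | tri< lower _    _     = ⊥-elim (¬lower lower)
      ... | tri≈ _    x≡σx _     = ⊥-elim (¬fixed (sym x≡σx))
      ... | tri> _    _    upper = upper

    sumWhere-involution : (w : A → ℕ) →
      sumWhere P? w xs ≡ sumWhere (P? ∩? Fixed?) w xs + sumWhere (P? ∩? Lower?) (λ x → w x + w (σ x)) xs
    sumWhere-involution w = begin
      sumWhere P? w xs
        ≡⟨ sumWhere-split P? Fixed? w xs ⟩
      sumWhere (P? ∩? Fixed?) w xs + sumWhere (P? ∩? ∁? Fixed?) w xs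
        ≡⟨ cong (_+_ (sumWhere (P? ∩? Fixed?) w xs)) (sumWhere-split (P? ∩? ∁? Fixed?) Lower? w xs) ⟩
      sumWhere (P? ∩? Fixed?) w xs + (sumWhere ((P? ∩? ∁? Fixed?) ∩? Lower?) w xs + sumWhere ((P? ∩? ∁? Fixed?) ∩? ∁? Lower?) w xs)
        ≡⟨ cong (_+_ (sumWhere (P? ∩? Fixed?) w xs)) (cong₂ _+_ lower (trans upper reflect)) ⟩
      sumWhere (P? ∩? Fixed?) w xs + (sumWhere (P? ∩? Lower?) w xs + sumWhere (P? ∩? Lower?) (w ∘ σ) xs)
        ≡⟨ cong (_+_ (sumWhere (P? ∩? Fixed?) w xs)) (sumWhere-+ (P? ∩? Lower?) w (w ∘ σ) xs) ⟨
      sumWhere (P? ∩? Fixed?) w xs + sumWhere (P? ∩? Lower?) (λ x → w x + w (σ x)) xs ∎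
      where
      lower : sumWhere ((P? ∩? ∁? Fixed?) ∩? Lower?) w xs ≡ sumWhere (P? ∩? Lower?) w xs
      lower = sumWhere-cong _ _ w xs (λ ((p , _) , l) → p , l)
                                     (λ (p , l) → (p , (λ σx≡x → tri⇒irr compare (sym σx≡x) l)) , l)
      upper : sumWhere ((P? ∩? ∁? Fixed?) ∩? ∁? Lower?) w xs ≡ sumWhere (P? ∩? Upper?) w xs
      upper = sumWhere-cong _ _ w xs (λ ((p , ¬fixed) , ¬lower) → p , non-fixed ¬fixed ¬lower)
                                     (λ (p , u) → (p , (λ σx≡x → tri⇒irr compare σx≡x u)) , tri⇒asym compare u)
      reflect : sumWhere (P? ∩? Upper?) w xs ≡ sumWhere (P? ∩? Lower?) (w ∘ σ) xs
      reflect = sumWhere-bijection (P? ∩? Lower?) (P? ∩? Upper?) xs xs xs-unique xs-unique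
        (P⊆xs ∘ proj₁) (P⊆xs ∘ proj₁) σ σ
        (λ (p , l) → σ-closed p , subst (_≺ σ _) (sym (σ-involutive p)) l)
        (λ (p , u) → σ-closed p , subst (σ _ ≺_) (sym (σ-involutive p)) u)
        (σ-involutive ∘ proj₁) (σ-involutive ∘ proj₁) w

  sumWhere-mod : {A : Set} {P : A → Set} (P? : Decidable P) {k : ℤ} (w w′ : A → ℕ) (xs : List A) →
    (∀ {x} → P x → + w x ≡ + w′ x [mod k ]) → + sumWhere P? w xs ≡ + sumWhere P? w′ xs [mod k ]
  sumWhere-mod P? {k} w w′ [] _ = mod (divides (+ 0) (sym (ℤₚ.*-zeroˡ k)))
  sumWhere-mod P? {k} w w′ (x ∷ xs) w≡w′ with P? x
  ... | no _  = sumWhere-mod P? w w′ xs w≡w′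
  ... | yes p = mod (subst (k ∣_) (sym regroup)
                  (∣m∣n⇒∣m+n (divides-difference (w≡w′ p)) (divides-difference (sumWhere-mod P? w w′ xs w≡w′))))
    where
    interchange : ∀ a b c d → (a ℤ.+ b) ℤ.- (c ℤ.+ d) ≡ (a ℤ.- c) ℤ.+ (b ℤ.- d)
    interchange = ℤ-Solver.solve-∀
    regroup : + (w x + sumWhere P? w xs) ℤ.- + (w′ x + sumWhere P? w′ xs)
            ≡ (+ w x ℤ.- + w′ x) ℤ.+ (+ sumWhere P? w xs ℤ.- + sumWhere P? w′ xs)
    regroup = trans (cong₂ ℤ._-_ (ℤₚ.pos-+ (w x) _) (ℤₚ.pos-+ (w′ x) _))
                    (interchange (+ w x) (+ sumWhere P? w xs) (+ w′ x) (+ sumWhere P? w′ xs))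

  ∑List : {A : Set} → (A → ℤ) → List A → ℤ
  ∑List h xs = foldr ℤ._+_ (+ 0) (map h xs)

  ∑List-++ : {A : Set} (h : A → ℤ) (xs ys : List A) → ∑List h (xs ++ ys) ≡ ∑List h xs ℤ.+ ∑List h ys
  ∑List-++ h []       ys = sym (ℤₚ.+-identityˡ _)
  ∑List-++ h (x ∷ xs) ys = trans (cong (ℤ._+_ (h x)) (∑List-++ h xs ys)) (sym (ℤₚ.+-assoc (h x) _ _))

  ∑List-map : {A B : Set} (h : B → ℤ) (g : A → B) (xs : List A) → ∑List h (map g xs) ≡ ∑List (h ∘ g) xs
  ∑List-map h g []       = refl
  ∑List-map h g (x ∷ xs) = cong (ℤ._+_ (h (g x))) (∑List-map h g xs)

  ∑List-cartesianProduct : {A B : Set} (h : A × B → ℤ) (xs : List A) (ys : List B) →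
    ∑List h (cartesianProduct xs ys) ≡ ∑List (λ x → ∑List (λ y → h (x , y)) ys) xs
  ∑List-cartesianProduct h []       ys = refl
  ∑List-cartesianProduct h (x ∷ xs) ys =
    trans (∑List-++ h (map (x ,_) ys) _) (cong₂ ℤ._+_ (∑List-map h (x ,_) ys) (∑List-cartesianProduct h xs ys))

  count-as-∑List : {A : Set} {P : A → Set} (P? : Decidable P) (xs : List A) →
    + sumWhere P? (λ _ → 1) xs ≡ ∑List (indicator ∘ P?) xs
  count-as-∑List P? []       = refl
  count-as-∑List P? (x ∷ xs) with P? x
  ... | yes _ = trans (ℤₚ.pos-+ 1 _) (cong (ℤ._+_ (+ 1)) (count-as-∑List P? xs))
  ... | no _  = trans (count-as-∑List P? xs) (sym (ℤₚ.+-identityˡ _))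

  pairsBelow : ℕ → List (ℕ × ℕ)
  pairsBelow K = cartesianProduct (upTo K) (upTo K)

  triplesBelow : ℕ → List (ℕ × (ℕ × ℕ))
  triplesBelow K = cartesianProduct (upTo K) (pairsBelow K)

  pairsBelow-unique : ∀ K → Unique (pairsBelow K)
  pairsBelow-unique K = cartesianProduct⁺ (upTo⁺ K) (upTo⁺ K)

  triplesBelow-unique : ∀ K → Unique (triplesBelow K)
  triplesBelow-unique K = cartesianProduct⁺ (upTo⁺ K) (pairsBelow-unique K)

  ∈-pairsBelow : ∀ {K a b} → a < K → b < K → (a , b) ∈ pairsBelow K
  ∈-pairsBelow a<K b<K = ∈-cartesianProduct⁺ (∈-upTo⁺ a<K) (∈-upTo⁺ b<K)

  ∈-triplesBelow : ∀ {K a b c} → a < K → b < K → c < K → (a , (b , c)) ∈ triplesBelow K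
  ∈-triplesBelow a<K b<K c<K = ∈-cartesianProduct⁺ (∈-upTo⁺ a<K) (∈-pairsBelow b<K c<K)

  count-pairsBelow : {P : ℕ × ℕ → Set} (P? : Decidable P) (K : ℕ) →
    + sumWhere P? (λ _ → 1) (pairsBelow K) ≡ ∑< K (λ a → ∑< K (λ b → indicator (P? (a , b))))
  count-pairsBelow P? K = begin
    + sumWhere P? (λ _ → 1) (pairsBelow K)                               ≡⟨ count-as-∑List P? (pairsBelow K) ⟩
    ∑List (indicator ∘ P?) (pairsBelow K)                                ≡⟨ ∑List-cartesianProduct (indicator ∘ P?) (upTo K) (upTo K) ⟩
    ∑List (λ a → ∑List (λ b → indicator (P? (a , b))) (upTo K)) (upTo K) ≡⟨ foldr-+-map-applyUpTo _ (λ i → i) K ⟩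
    ∑< K (λ a → ∑List (λ b → indicator (P? (a , b))) (upTo K))          ≡⟨ ∑-cong K (λ a _ → foldr-+-map-applyUpTo _ (λ i → i) K) ⟩
    ∑< K (λ a → ∑< K (λ b → indicator (P? (a , b))))                    ∎

  count-upTo : ∀ r → sumWhere (ℕₚ._<? r) (λ _ → 1) (upTo r) ≡ r
  count-upTo r = trans (cong (sum ∘ map (λ _ → 1)) (filter-all (ℕₚ._<? r) (All.tabulate ∈-upTo⁻)))
                       (trans (sum-of-ones (upTo r)) (length-upTo r))
    where
    sum-of-ones : ∀ {A : Set} (xs : List A) → sum (map (λ _ → 1) xs) ≡ length xs
    sum-of-ones []       = refl
    sum-of-ones (_ ∷ xs) = cong ℕ.suc (sum-of-ones xs)

  _<lex_ : ℕ × ℕ → ℕ × ℕ → Set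
  _<lex_ = ×-Lex _≡_ _<_ _<_

  <lex-compare : Trichotomous _≡_ _<lex_
  <lex-compare = lex-compare ℕₚ.<-cmp ℕₚ.<-cmp

  <lex₃-compare : Trichotomous _≡_ (×-Lex _≡_ _<_ _<lex_)
  <lex₃-compare = lex-compare ℕₚ.<-cmp <lex-compare

  swap-<lex : ∀ {a b} → (a , b) <lex (b , a) → a < b
  swap-<lex (inj₁ a<b)         = a<b
  swap-<lex (inj₂ (refl , a<a)) = ⊥-elim (ℕₚ.<-irrefl refl a<a)

module ThetaSeries where

  open IntegerSums
  open PowerSeries
  open FiniteCounting using (sumWhere; pairsBelow; count-pairsBelow)
  open import Data.Product using (_×_; _,_)
  open import Relation.Unary using (Decidable)
  open import Data.Nat as ℕ using (ℕ; zero; suc; _∸_; _<_; _≤_; s≤s; _≟_; _^_)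
  import Data.Nat.Properties as ℕₚ
  open import Data.Nat.Tactic.RingSolver as ℕ-Solver using ()
  open import Data.Integer using (ℤ; +_; _+_; _*_; -_; _-_; ∣_∣)
  open import Data.Integer.Properties hiding (_≟_)
  open import Data.Integer.Tactic.RingSolver using (solve-∀)
  open import Data.List using (map; upTo)
  open import Data.List.Properties using (map-∘)
  open import Data.Bool using (if_then_else_)
  open import Relation.Nullary using (Dec; does; yes; no)
  open ≡-Reasoning

  thetaTerm : (ℤ → ℤ) → (ℤ → ℕ) → ℕ → ℤ → ℤ
  thetaTerm w e N n = if does (e n ≟ N) then w n else + 0

  ∑-ints : ∀ N (t : ℤ → ℤ) →
    ∑[ i < suc (N ℕ.* 2) ] t (+ i - + N) ≡ (∑[ i < N ] t (- + suc i)) + (∑[ i < suc N ] t (+ i))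
  ∑-ints N t = begin
    ∑[ i < suc (N ℕ.* 2) ] t (+ i - + N)                              ≡⟨ cong (λ n → ∑[ i < n ] t (+ i - + N)) length ⟩
    ∑[ i < N ℕ.+ suc N ] t (+ i - + N)                                ≡⟨ ∑-split N (suc N) (λ i → t (+ i - + N)) ⟩
    (∑[ i < N ] t (+ i - + N)) + (∑[ i < suc N ] t (+ (N ℕ.+ i) - + N)) ≡⟨ cong₂ _+_ negative nonnegative ⟩
    (∑[ i < N ] t (- + suc i)) + (∑[ i < suc N ] t (+ i))             ∎
    where
    length : suc (N ℕ.* 2) ≡ N ℕ.+ suc N
    length = double N
      where
      double : ∀ N → suc (N ℕ.* 2) ≡ N ℕ.+ suc N
      double = ℕ-Solver.solve-∀
    negative : ∑[ i < N ] t (+ i - + N) ≡ ∑[ i < N ] t (- + suc i)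
    negative = trans (∑-reverse N (λ i → t (+ i - + N))) (∑-cong N (λ i i<N → cong t (offset i i<N)))
      where
      offset : ∀ i → i < N → + (N ∸ suc i) - + N ≡ - + suc i
      offset i i<N = begin
        + (N ∸ suc i) - + N                   ≡⟨ cong (λ n → + (N ∸ suc i) - + n) (ℕₚ.m∸n+n≡m i<N) ⟨
        + (N ∸ suc i) - + (N ∸ suc i ℕ.+ suc i) ≡⟨ cong (_-_ (+ (N ∸ suc i))) (pos-+ (N ∸ suc i) (suc i)) ⟩
        + (N ∸ suc i) - (+ (N ∸ suc i) + + suc i) ≡⟨ cancel (+ (N ∸ suc i)) (+ suc i) ⟩
        - + suc i                             ∎
        where
        cancel : ∀ x y → x - (x + y) ≡ - y
        cancel = solve-∀
    nonnegative : ∑[ i < suc N ] t (+ (N ℕ.+ i) - + N) ≡ ∑[ i < suc N ] t (+ i)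
    nonnegative = ∑-cong (suc N) (λ i _ → cong t (trans (cong (_- + N) (pos-+ N i)) (cancel (+ N) (+ i))))
      where
      cancel : ∀ x y → x + y - x ≡ y
      cancel = solve-∀

  thetaLike-as-∑ : ∀ w e N → thetaLike w e N ≡ (∑[ i < N ] thetaTerm w e N (- + suc i)) + (∑[ i < suc N ] thetaTerm w e N (+ i))
  thetaLike-as-∑ w e N = begin
    thetaLike w e N
      ≡⟨ cong (Data.List.foldr _+_ (+ 0)) (map-∘ {g = thetaTerm w e N} {f = λ i → + i - + N} (upTo (suc (N ℕ.* 2)))) ⟨
    Data.List.foldr _+_ (+ 0) (map (λ i → thetaTerm w e N (+ i - + N)) (upTo (suc (N ℕ.* 2))))
      ≡⟨ foldr-+-map-applyUpTo (λ i → thetaTerm w e N (+ i - + N)) (λ i → i) (suc (N ℕ.* 2)) ⟩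
    ∑[ i < suc (N ℕ.* 2) ] thetaTerm w e N (+ i - + N)
      ≡⟨ ∑-ints N (thetaTerm w e N) ⟩
    (∑[ i < N ] thetaTerm w e N (- + suc i)) + (∑[ i < suc N ] thetaTerm w e N (+ i)) ∎

  thetaLike-abs≋one : ∀ (W : ℕ → ℤ) (E : ℕ → ℕ) → E 0 ≡ 0 → W 0 ≡ + 1 →
    thetaLike (W ∘ ∣_∣) (E ∘ ∣_∣) ≋ one [mod + 2 ]
  thetaLike-abs≋one W E E0≡0 W0≡1 N =
    subst (_≡ one N [mod + 2 ]) (sym folded) (double+-mod2 S (one N))
    where
    t = thetaTerm (W ∘ ∣_∣) (E ∘ ∣_∣) N
    centre : ∀ M → thetaTerm (W ∘ ∣_∣) (E ∘ ∣_∣) M (+ 0) ≡ one M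
    centre zero    rewrite E0≡0 | W0≡1 = refl
    centre (suc M) rewrite E0≡0 = refl
    S = ∑[ i < N ] t (+ suc i)
    folded : thetaLike (W ∘ ∣_∣) (E ∘ ∣_∣) N ≡ S + S + one N
    folded = begin
      thetaLike (W ∘ ∣_∣) (E ∘ ∣_∣) N ≡⟨ thetaLike-as-∑ (W ∘ ∣_∣) (E ∘ ∣_∣) N ⟩
      S + (t (+ 0) + S)              ≡⟨ cong (λ z → S + (z + S)) (centre N) ⟩
      S + (one N + S)                ≡⟨ rearrange S (one N) ⟩
      S + S + one N                  ∎
      where
      rearrange : ∀ a b → a + (b + a) ≡ a + a + b
      rearrange = solve-∀

  θ₃≋one : θ₃ ≋ one [mod + 2 ]
  θ₃≋one = thetaLike-abs≋one (λ _ → + 1) (λ a → 4 ℕ.* (a ^ 2)) refl refl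

  θ₄≋one : θ₄ ≋ one [mod + 2 ]
  θ₄≋one = thetaLike-abs≋one (λ a → sgn (a ^ 2)) (λ a → 4 ℕ.* (a ^ 2)) refl refl

  oddSquare : ℕ → ℕ
  oddSquare i = suc (i ℕ.+ i) ℕ.* suc (i ℕ.+ i)

  n<oddSquare : ∀ n → n < oddSquare n
  n<oddSquare n = ℕₚ.<-≤-trans (s≤s (ℕₚ.m≤m+n n n)) (ℕₚ.m≤m*n (suc (n ℕ.+ n)) (suc (n ℕ.+ n)))

  -- halfθ₂ = ∑_{k ≥ 0} t^{(2k+1)²}; in θ₂ the terms k and -1-k coincide.
  halfθ₂ : Series
  halfθ₂ N = ∑[ i < N ] indicator (oddSquare i ≟ N)

  θ₂≗2·halfθ₂ : θ₂ ≗ + 2 · halfθ₂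
  θ₂≗2·halfθ₂ N = begin
    θ₂ N
      ≡⟨ thetaLike-as-∑ (λ _ → + 1) e N ⟩
    (∑[ i < N ] t (- + suc i)) + (∑[ i < suc N ] t (+ i))
      ≡⟨ cong₂ _+_ (∑-cong N (λ i _ → cong (λ z → indicator (z ^ 2 ≟ N)) (abs-negative i)))
                   (∑-cong (suc N) (λ i _ → cong (λ z → indicator (z ^ 2 ≟ N)) (abs-nonnegative i))) ⟩
    (∑[ i < N ] indicator (suc (i ℕ.+ i) ^ 2 ≟ N)) + (∑[ i < suc N ] indicator (suc (i ℕ.+ i) ^ 2 ≟ N))
      ≡⟨ cong₂ _+_ (∑-cong N (λ i _ → square i)) (∑-cong (suc N) (λ i _ → square i)) ⟩
    halfθ₂ N + (∑[ i < suc N ] indicator (oddSquare i ≟ N))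
      ≡⟨ cong (_+_ (halfθ₂ N)) (∑-last N (λ i → indicator (oddSquare i ≟ N))) ⟩
    halfθ₂ N + (halfθ₂ N + indicator (oddSquare N ≟ N))
      ≡⟨ cong (λ z → halfθ₂ N + (halfθ₂ N + z)) (indicator-no (oddSquare N ≟ N) (ℕₚ.<⇒≢ (n<oddSquare N) ∘ sym)) ⟩
    halfθ₂ N + (halfθ₂ N + + 0)
      ≡⟨ double (halfθ₂ N) ⟩
    + 2 * halfθ₂ N ∎
    where
    e : ℤ → ℕ
    e k = ∣ + 2 * k + + 1 ∣ ^ 2
    t = thetaTerm (λ _ → + 1) e N
    square : ∀ i → indicator (suc (i ℕ.+ i) ^ 2 ≟ N) ≡ indicator (oddSquare i ≟ N)
    square i = cong (λ z → indicator (suc (i ℕ.+ i) ℕ.* z ≟ N)) (ℕₚ.*-identityʳ (suc (i ℕ.+ i)))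
    abs-nonnegative : ∀ i → ∣ + 2 * + i + + 1 ∣ ≡ suc (i ℕ.+ i)
    abs-nonnegative i = cong ∣_∣ (begin
      + 2 * + i + + 1      ≡⟨ cong (_+ + 1) (pos-* 2 i) ⟨
      + (2 ℕ.* i) + + 1    ≡⟨ pos-+ (2 ℕ.* i) 1 ⟨
      + (2 ℕ.* i ℕ.+ 1)    ≡⟨ cong +_ (twice i) ⟩
      + suc (i ℕ.+ i)      ∎)
      where
      twice : ∀ i → 2 ℕ.* i ℕ.+ 1 ≡ suc (i ℕ.+ i)
      twice = ℕ-Solver.solve-∀
    abs-negative : ∀ i → ∣ + 2 * - + suc i + + 1 ∣ ≡ suc (i ℕ.+ i)
    abs-negative i = begin
      ∣ + 2 * - + suc i + + 1 ∣  ≡⟨ cong (λ z → ∣ + 2 * - z + + 1 ∣) (pos-+ 1 i) ⟩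
      ∣ + 2 * - (+ 1 + + i) + + 1 ∣ ≡⟨ cong ∣_∣ (reflect (+ i)) ⟩
      ∣ - (+ 2 * + i + + 1) ∣    ≡⟨ ∣-i∣≡∣i∣ (+ 2 * + i + + 1) ⟩
      ∣ + 2 * + i + + 1 ∣        ≡⟨ abs-nonnegative i ⟩
      suc (i ℕ.+ i)             ∎
      where
      reflect : ∀ a → + 2 * - (+ 1 + a) + + 1 ≡ - (+ 2 * a + + 1)
      reflect = solve-∀
    double : ∀ a → a + (a + + 0) ≡ + 2 * a
    double = solve-∀

  θ₃²Δ₈ : Series
  θ₃²Δ₈ = pow θ₃ 2 ⊛ pow halfθ₂ 4 ⊛ pow θ₄ 4

  sixteenθ₃²Δ₈≗16·θ₃²Δ₈ : sixteenθ₃²Δ₈ ≗ + 16 · θ₃²Δ₈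
  sixteenθ₃²Δ₈≗16·θ₃²Δ₈ N = begin
    (pow θ₃ 2 ⊛ pow θ₂ 4 ⊛ pow θ₄ 4) N
      ≡⟨ ⊛-congʳ (pow θ₄ 4) (⊛-congˡ (pow θ₃ 2) θ₂⁴≗16·halfθ₂⁴) N ⟩
    (pow θ₃ 2 ⊛ + 16 · pow halfθ₂ 4 ⊛ pow θ₄ 4) N
      ≡⟨ ⊛-congʳ (pow θ₄ 4) (⊛-·ʳ (+ 16) (pow θ₃ 2) (pow halfθ₂ 4)) N ⟩
    (+ 16 · (pow θ₃ 2 ⊛ pow halfθ₂ 4) ⊛ pow θ₄ 4) N
      ≡⟨ ⊛-·ˡ (+ 16) (pow θ₃ 2 ⊛ pow halfθ₂ 4) (pow θ₄ 4) N ⟩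
    (+ 16 · θ₃²Δ₈) N ∎
    where
    θ₂⁴≗16·halfθ₂⁴ : pow θ₂ 4 ≗ + 16 · pow halfθ₂ 4
    θ₂⁴≗16·halfθ₂⁴ M = trans (pow-cong 4 θ₂≗2·halfθ₂ M) (pow-· (+ 2) halfθ₂ 4 M)

  θ₃²Δ₈≋halfθ₂⁴ : θ₃²Δ₈ ≋ pow halfθ₂ 4 [mod + 4 ]
  θ₃²Δ₈≋halfθ₂⁴ = ≋-trans (⊛-≋ (⊛-≋ (pow-two≋one θ₃≋one) (≋-refl (pow halfθ₂ 4))) (pow-four≋one θ₄≋one))
                          (≗⇒≋ (λ N → trans (⊛-identityʳ (one ⊛ pow halfθ₂ 4) N) (⊛-identityˡ (pow halfθ₂ 4) N)))

  halfθ₂-as-∑ : ∀ i K → i ≤ K → halfθ₂ i ≡ ∑[ a < K ] indicator (oddSquare a ≟ i)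
  halfθ₂-as-∑ i K i≤K = begin
    halfθ₂ i                                                                     ≡⟨ +-identityʳ _ ⟨
    halfθ₂ i + + 0                                                               ≡⟨ cong (_+_ (halfθ₂ i)) tail-vanishes ⟨
    halfθ₂ i + (∑[ j < K ∸ i ] indicator (oddSquare (i ℕ.+ j) ≟ i))               ≡⟨ ∑-split i (K ∸ i) _ ⟨
    ∑[ a < i ℕ.+ (K ∸ i) ] indicator (oddSquare a ≟ i)
      ≡⟨ cong (λ n → ∑[ a < n ] indicator (oddSquare a ≟ i)) (ℕₚ.m+[n∸m]≡n i≤K) ⟩
    ∑[ a < K ] indicator (oddSquare a ≟ i)                                        ∎
    where
    tail-vanishes : ∑[ j < K ∸ i ] indicator (oddSquare (i ℕ.+ j) ≟ i) ≡ + 0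
    tail-vanishes = trans (∑-cong (K ∸ i) (λ j _ → indicator-no (oddSquare (i ℕ.+ j) ≟ i) (too-big j))) (∑-zero (K ∸ i))
      where
      too-big : ∀ j → oddSquare (i ℕ.+ j) ≢ i
      too-big j eq = ℕₚ.<⇒≢ (ℕₚ.≤-<-trans (ℕₚ.m≤m+n i j) (n<oddSquare (i ℕ.+ j))) (sym eq)

  OddSquarePair : ℕ → ℕ × ℕ → Set
  OddSquarePair n (a , b) = oddSquare a ℕ.+ oddSquare b ≡ n

  oddSquarePair? : ∀ n → Decidable (OddSquarePair n)
  oddSquarePair? n (a , b) = oddSquare a ℕ.+ oddSquare b ≟ n

  ∑-oddSquare-δ : ∀ n a b →
    ∑[ i < suc n ] indicator (oddSquare a ≟ i) * indicator (oddSquare b ≟ n ∸ i) ≡ indicator (oddSquarePair? n (a , b))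
  ∑-oddSquare-δ n a b with oddSquare a ℕₚ.<? suc n
  ... | yes a²≤n = trans (∑-δ-inside (suc n) (oddSquare a) (λ i → indicator (oddSquare b ≟ n ∸ i)) a²≤n)
                          (same-indicator (oddSquare b ≟ n ∸ oddSquare a) (oddSquarePair? n (a , b)) to from)
    where
    same-indicator : ∀ {X Y : Set} (x? : Dec X) (y? : Dec Y) → (X → Y) → (Y → X) → indicator x? ≡ indicator y?
    same-indicator (yes x) y? to _    = sym (indicator-yes y? (to x))
    same-indicator (no ¬x) y? _  from = sym (indicator-no y? (¬x ∘ from))
    to : oddSquare b ≡ n ∸ oddSquare a → OddSquarePair n (a , b)
    to eq = trans (cong (oddSquare a ℕ.+_) eq) (ℕₚ.m+[n∸m]≡n (ℕₚ.≤-pred a²≤n))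
    from : OddSquarePair n (a , b) → oddSquare b ≡ n ∸ oddSquare a
    from eq = trans (sym (ℕₚ.m+n∸m≡n (oddSquare a) (oddSquare b))) (cong (_∸ oddSquare a) eq)
  ... | no  a²≰n = trans (∑-δ-outside (suc n) (oddSquare a) (λ i → indicator (oddSquare b ≟ n ∸ i)) a²≰n)
                         (sym (indicator-no (oddSquarePair? n (a , b)) (λ eq → a²≰n (s≤s (subst (oddSquare a ℕ.≤_) eq (ℕₚ.m≤m+n _ _))))))

  halfθ₂²-counts : ∀ n → (halfθ₂ ⊛ halfθ₂) n ≡ + sumWhere (oddSquarePair? n) (λ _ → 1) (pairsBelow (suc n))
  halfθ₂²-counts n = begin
    (halfθ₂ ⊛ halfθ₂) n
      ≡⟨ ⊛-as-∑ halfθ₂ halfθ₂ n ⟩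
    ∑[ i < suc n ] halfθ₂ i * halfθ₂ (n ∸ i)
      ≡⟨ ∑-cong (suc n) (λ i i≤n → expand i (ℕₚ.≤-pred i≤n)) ⟩
    ∑[ i < suc n ] ∑[ a < suc n ] ∑[ b < suc n ] term i a b
      ≡⟨ ∑-swap (suc n) (suc n) (λ i a → ∑[ b < suc n ] term i a b) ⟩
    ∑[ a < suc n ] ∑[ i < suc n ] ∑[ b < suc n ] term i a b
      ≡⟨ ∑-cong (suc n) (λ a _ → ∑-swap (suc n) (suc n) (λ i b → term i a b)) ⟩
    ∑[ a < suc n ] ∑[ b < suc n ] ∑[ i < suc n ] term i a b
      ≡⟨ ∑-cong (suc n) (λ a _ → ∑-cong (suc n) (λ b _ → ∑-oddSquare-δ n a b)) ⟩
    ∑[ a < suc n ] ∑[ b < suc n ] indicator (oddSquarePair? n (a , b))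
      ≡⟨ count-pairsBelow (oddSquarePair? n) (suc n) ⟨
    + sumWhere (oddSquarePair? n) (λ _ → 1) (pairsBelow (suc n)) ∎
    where
    term : ℕ → ℕ → ℕ → ℤ
    term i a b = indicator (oddSquare a ≟ i) * indicator (oddSquare b ≟ n ∸ i)
    expand : ∀ i → i ≤ n → halfθ₂ i * halfθ₂ (n ∸ i) ≡ ∑[ a < suc n ] ∑[ b < suc n ] term i a b
    expand i i≤n = begin
      halfθ₂ i * halfθ₂ (n ∸ i)
        ≡⟨ cong₂ _*_ (halfθ₂-as-∑ i (suc n) (ℕₚ.m≤n⇒m≤1+n i≤n))
                     (halfθ₂-as-∑ (n ∸ i) (suc n) (ℕₚ.m≤n⇒m≤1+n (ℕₚ.m∸n≤m n i))) ⟩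
      ∑< (suc n) α * ∑< (suc n) β                 ≡⟨ *-comm (∑< (suc n) α) (∑< (suc n) β) ⟩
      ∑< (suc n) β * ∑< (suc n) α                 ≡⟨ ∑-*ˡ (suc n) (∑< (suc n) β) α ⟨
      ∑[ a < suc n ] ∑< (suc n) β * α a
        ≡⟨ ∑-cong (suc n) (λ a _ → trans (*-comm (∑< (suc n) β) (α a)) (sym (∑-*ˡ (suc n) (α a) β))) ⟩
      ∑[ a < suc n ] ∑[ b < suc n ] term i a b    ∎
      where
      α β : ℕ → ℤ
      α a = indicator (oddSquare a ≟ i)
      β b = indicator (oddSquare b ≟ n ∸ i)

module RepresentationCounts (m : ℕ) (m-odd : Parity.Odd m) where

  open Parity
  open FiniteCounting
  open ThetaSeries using (oddSquare; n<oddSquare; OddSquarePair; oddSquarePair?)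
  open import Data.Nat as ℕ using (ℕ; zero; suc; _∸_; _<_; _≤_; z≤n; s≤s; _≟_; _+_; _*_; ⌊_/2⌋)
  import Data.Nat.Properties as ℕₚ
  open import Data.Nat.Tactic.RingSolver using (solve-∀)
  open IntegerSums using (_≡_[mod_]; +-mod; a+k*x≡b+k*y⇒a≡b-mod; ≡⇒≡-mod; mod-trans; mod-sym)
  open import Data.Integer as ℤ using (+_)
  import Data.Integer.Properties as ℤₚ
  open import Data.Nat.Divisibility using (_∣_; _∣?_; divides; 0∣⇒≡0; ∣⇒≤)
  open import Data.Nat.DivMod using (m*n/n≡m)
  open import Data.Nat.ListAction using (sum)
  open import Data.List using (map; filter; upTo)
  open import Data.List.Properties using (map-id)
  open import Data.List.Membership.Propositional using (_∈_)
  open import Data.List.Membership.Propositional.Properties using (∈-map⁺; ∈-upTo⁺)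
  open import Data.List.Relation.Unary.Unique.Propositional.Properties using (map⁺; upTo⁺)
  open import Data.Product using (∃; _,_; _×_; proj₁; proj₂; swap)
  open import Data.Sum using (_⊎_; inj₁; inj₂)
  open import Data.Empty using (⊥-elim)
  open import Relation.Nullary using (yes; no; ¬_)
  open import Relation.Nullary.Decidable using (_×-dec_)
  open import Relation.Unary using (Decidable; _∩_; ∁)
  open import Relation.Unary.Properties using (_∩?_; ∁?)
  open import Relation.Binary.Definitions using (tri<; tri≈; tri>)

  -- Every coordinate of every point counted below is at most 2m.
  bound : ℕ
  bound = suc (m + m)

  ≤2m⇒<bound : ∀ {a t} → a ≤ t → t ≤ m + m → a < bound
  ≤2m⇒<bound a≤t t≤2m = s≤s (ℕₚ.≤-trans a≤t t≤2m)

  count₂ : {P : ℕ × ℕ → Set} → Decidable P → ℕ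
  count₂ P? = sumWhere P? (λ _ → 1) (pairsBelow bound)

  count₃ : {P : ℕ × (ℕ × ℕ) → Set} → Decidable P → ℕ
  count₃ P? = sumWhere P? (λ _ → 1) (triplesBelow bound)

  m≢double : ∀ k → m ≢ k + k
  m≢double k m≡k+k = even⇒¬odd (k , m≡k+k) m-odd

  <⇒∃+suc : ∀ {a b} → a < b → ∃ λ d → b ≡ a + suc d
  <⇒∃+suc {zero}  {suc b} _         = b , refl
  <⇒∃+suc {suc a} {suc b} (s≤s a<b) with <⇒∃+suc a<b
  ... | d , refl = d , refl

  1≤⇒≡suc : ∀ {n} → 1 ≤ n → ∃ λ k → n ≡ suc k
  1≤⇒≡suc {suc k} _ = k , refl

  n≤n*n : ∀ {n} → 1 ≤ n → n ≤ n * n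
  n≤n*n {suc n} _ = ℕₚ.m≤m*n (suc n) (suc n)

  ⌊1+n+n/2⌋≡n : ∀ n → ⌊ suc (n + n) /2⌋ ≡ n
  ⌊1+n+n/2⌋≡n zero    = refl
  ⌊1+n+n/2⌋≡n (suc n) = trans (cong (λ k → ⌊ suc (suc k) /2⌋) (ℕₚ.+-suc n n)) (cong suc (⌊1+n+n/2⌋≡n n))

  OddSquares : ℕ × ℕ → Set
  OddSquares = OddSquarePair (m + m)

  oddSquares? : Decidable OddSquares
  oddSquares? = oddSquarePair? (m + m)

  OddSquares-swap : ∀ {p} → OddSquares p → OddSquares (swap p)
  OddSquares-swap {a , b} eq = trans (ℕₚ.+-comm (oddSquare b) (oddSquare a)) eq

  OddSquares⊆pairsBelow : ∀ {p} → OddSquares p → p ∈ pairsBelow bound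
  OddSquares⊆pairsBelow {a , b} eq = ∈-pairsBelow
    (≤2m⇒<bound (ℕₚ.≤-trans (ℕₚ.<⇒≤ (n<oddSquare a)) (ℕₚ.m≤m+n (oddSquare a) (oddSquare b))) (ℕₚ.≤-reflexive eq))
    (≤2m⇒<bound (ℕₚ.≤-trans (ℕₚ.<⇒≤ (n<oddSquare b)) (ℕₚ.m≤n+m (oddSquare b) (oddSquare a))) (ℕₚ.≤-reflexive eq))

  module SwapOddSquares = Involution <lex-compare oddSquares? swap (λ {p} → OddSquares-swap {p}) (λ _ → refl)
                                     (pairsBelow bound) (pairsBelow-unique bound) (λ {p} → OddSquares⊆pairsBelow {p})

  TwoSquares : ℕ × ℕ → Set
  TwoSquares (u , v) = u * u + v * v ≡ m × 1 ≤ u × 1 ≤ v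

  twoSquares? : Decidable TwoSquares
  twoSquares? (u , v) = (u * u + v * v ≟ m) ×-dec (1 ℕₚ.≤? u) ×-dec (1 ℕₚ.≤? v)

  TwoSquares-swap : ∀ {p} → TwoSquares p → TwoSquares (swap p)
  TwoSquares-swap {u , v} (eq , 1≤u , 1≤v) = trans (ℕₚ.+-comm (v * v) (u * u)) eq , 1≤v , 1≤u

  TwoSquares⊆pairsBelow : ∀ {p} → TwoSquares p → p ∈ pairsBelow bound
  TwoSquares⊆pairsBelow {u , v} (eq , 1≤u , 1≤v) = ∈-pairsBelow
    (≤2m⇒<bound (ℕₚ.≤-trans (n≤n*n 1≤u) (ℕₚ.m≤m+n (u * u) (v * v))) sum≤2m)
    (≤2m⇒<bound (ℕₚ.≤-trans (n≤n*n 1≤v) (ℕₚ.m≤n+m (v * v) (u * u))) sum≤2m)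
    where
    sum≤2m = ℕₚ.≤-trans (ℕₚ.≤-reflexive eq) (ℕₚ.m≤m+n m m)

  module SwapTwoSquares = Involution <lex-compare twoSquares? swap (λ {p} → TwoSquares-swap {p}) (λ _ → refl)
                                     (pairsBelow bound) (pairsBelow-unique bound) (λ {p} → TwoSquares⊆pairsBelow {p})

  sum-of-squares-parity : ∀ {u v} → u * u + v * v ≡ m → (Odd u × Even v) ⊎ (Even u × Odd v)
  sum-of-squares-parity {u} {v} eq with even-or-odd u | even-or-odd v
  ... | inj₁ even-u | inj₂ odd-v  = inj₂ (even-u , odd-v)
  ... | inj₂ odd-u  | inj₁ even-v = inj₁ (odd-u , even-v)
  ... | inj₁ even-u | inj₁ even-v = ⊥-elim (even⇒¬odd (subst Even eq (even+even (even*ˡ u even-u) (even*ˡ v even-v))) m-odd)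
  ... | inj₂ odd-u  | inj₂ odd-v  = ⊥-elim (even⇒¬odd (subst Even eq (odd+odd (odd*odd odd-u odd-u) (odd*odd odd-v odd-v))) m-odd)

  sum-of-squares-gap : ∀ {u e} → u * u + (u + e) * (u + e) ≡ m → Odd e
  sum-of-squares-gap {u} {e} eq with even-or-odd e | sum-of-squares-parity {u} {u + e} eq
  ... | inj₂ odd-e  | _                    = odd-e
  ... | inj₁ even-e | inj₁ (odd-u , even-v) = ⊥-elim (even⇒¬odd even-v (odd+even odd-u even-e))
  ... | inj₁ even-e | inj₂ (even-u , odd-v) = ⊥-elim (even⇒¬odd (even+even even-u even-e) odd-v)

  -- (2a+1)² + (2b+1)² = 2((b-a)² + (a+b+1)²) identifies the pairs a < b with the pairs u < v.
  toTwoSquares : ℕ × ℕ → ℕ × ℕ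
  toTwoSquares (a , b) = b ∸ a , a + b + 1

  toOddSquares : ℕ × ℕ → ℕ × ℕ
  toOddSquares (u , v) = ⌊ v ∸ u /2⌋ , u + ⌊ v ∸ u /2⌋

  toTwoSquares-on : ∀ a d → toTwoSquares (a , a + suc d) ≡ (suc d , a + (a + suc d) + 1)
  toTwoSquares-on a d = cong (_, a + (a + suc d) + 1) (ℕₚ.m+n∸m≡n a (suc d))

  toOddSquares-on : ∀ u c → toOddSquares (u , u + suc (c + c)) ≡ (c , u + c)
  toOddSquares-on u c rewrite ℕₚ.m+n∸m≡n u (suc (c + c)) | ⌊1+n+n/2⌋≡n c = refl

  toTwoSquares-maps : ∀ {p} → (OddSquares ∩ SwapOddSquares.Lower) p → (TwoSquares ∩ SwapTwoSquares.Lower) (toTwoSquares p)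
  toTwoSquares-maps {a , b} (eq , lower) with <⇒∃+suc (swap-<lex lower)
  ... | d , refl = subst (TwoSquares ∩ SwapTwoSquares.Lower) (sym (toTwoSquares-on a d))
                         ((sum≡m , s≤s z≤n , ℕₚ.m≤n+m 1 _) , inj₁ u<v)
    where
    identity : ∀ a d → suc (a + a) * suc (a + a) + suc ((a + suc d) + (a + suc d)) * suc ((a + suc d) + (a + suc d))
                     ≡ suc d * suc d + (a + (a + suc d) + 1) * (a + (a + suc d) + 1)
                     + (suc d * suc d + (a + (a + suc d) + 1) * (a + (a + suc d) + 1))
    identity = solve-∀
    sum≡m : suc d * suc d + (a + (a + suc d) + 1) * (a + (a + suc d) + 1) ≡ m
    sum≡m = double-injective (trans (sym (identity a d)) eq)
    u<v : suc d < a + (a + suc d) + 1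
    u<v = ℕₚ.≤-<-trans (ℕₚ.≤-trans (ℕₚ.m≤n+m (suc d) a) (ℕₚ.m≤n+m (a + suc d) a)) (ℕₚ.m<m+n (a + (a + suc d)) (s≤s z≤n))

  toOddSquares-maps : ∀ {p} → (TwoSquares ∩ SwapTwoSquares.Lower) p → (OddSquares ∩ SwapOddSquares.Lower) (toOddSquares p)
  toOddSquares-maps {u , v} ((eq , 1≤u , _) , lower) with <⇒∃+suc (swap-<lex lower)
  ... | d , refl with sum-of-squares-gap {u} {suc d} eq
  ...   | c , refl = subst (OddSquares ∩ SwapOddSquares.Lower) (sym (toOddSquares-on u c))
                           (trans (identity u c) (cong₂ _+_ eq eq) , inj₁ (ℕₚ.m<n+m c 1≤u))
    where
    identity : ∀ u c → suc (c + c) * suc (c + c) + suc ((u + c) + (u + c)) * suc ((u + c) + (u + c))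
                     ≡ u * u + (u + suc (c + c)) * (u + suc (c + c)) + (u * u + (u + suc (c + c)) * (u + suc (c + c)))
    identity = solve-∀

  toOddSquares∘toTwoSquares : ∀ {p} → (OddSquares ∩ SwapOddSquares.Lower) p → toOddSquares (toTwoSquares p) ≡ p
  toOddSquares∘toTwoSquares {a , b} (_ , lower) with <⇒∃+suc (swap-<lex lower)
  ... | d , refl = trans (cong toOddSquares (toTwoSquares-on a d))
                         (cong₂ _,_ half≡a (trans (cong (_+_ (suc d)) half≡a) (ℕₚ.+-comm (suc d) a)))
    where
    regroup : ∀ a d → a + (a + suc d) + 1 ≡ suc (a + a) + suc d
    regroup = solve-∀
    half≡a : ⌊ a + (a + suc d) + 1 ∸ suc d /2⌋ ≡ a
    half≡a = trans (cong (λ k → ⌊ k ∸ suc d /2⌋) (regroup a d))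
                   (trans (cong ⌊_/2⌋ (ℕₚ.m+n∸n≡m (suc (a + a)) (suc d))) (⌊1+n+n/2⌋≡n a))

  toTwoSquares∘toOddSquares : ∀ {p} → (TwoSquares ∩ SwapTwoSquares.Lower) p → toTwoSquares (toOddSquares p) ≡ p
  toTwoSquares∘toOddSquares {u , v} ((eq , _) , lower) with <⇒∃+suc (swap-<lex lower)
  ... | d , refl with sum-of-squares-gap {u} {suc d} eq
  ...   | c , refl = trans (cong toTwoSquares (toOddSquares-on u c)) (cong₂ _,_ (ℕₚ.m+n∸n≡m u c) (regroup u c))
    where
    regroup : ∀ u c → c + (u + c) + 1 ≡ u + suc (c + c)
    regroup = solve-∀

  #lowerOddSquares≡#lowerTwoSquares : count₂ (oddSquares? ∩? SwapOddSquares.Lower?) ≡ count₂ (twoSquares? ∩? SwapTwoSquares.Lower?)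
  #lowerOddSquares≡#lowerTwoSquares = sym (sumWhere-bijection
    (oddSquares? ∩? SwapOddSquares.Lower?) (twoSquares? ∩? SwapTwoSquares.Lower?)
    (pairsBelow bound) (pairsBelow bound) (pairsBelow-unique bound) (pairsBelow-unique bound)
    (λ {p} → OddSquares⊆pairsBelow {p} ∘ proj₁) (λ {p} → TwoSquares⊆pairsBelow {p} ∘ proj₁)
    toTwoSquares toOddSquares (λ {p} → toTwoSquares-maps {p}) (λ {p} → toOddSquares-maps {p})
    (λ {p} → toOddSquares∘toTwoSquares {p}) (λ {p} → toTwoSquares∘toOddSquares {p}) (λ _ → 1))

  OddFirst : ℕ × ℕ → Set
  OddFirst (u , _) = Odd u

  oddFirst? : Decidable OddFirst
  oddFirst? (u , _) = odd? u

  #evenFirst≡#oddFirst : count₂ (twoSquares? ∩? ∁? oddFirst?) ≡ count₂ (twoSquares? ∩? oddFirst?)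
  #evenFirst≡#oddFirst = sumWhere-bijection (twoSquares? ∩? oddFirst?) (twoSquares? ∩? ∁? oddFirst?)
    (pairsBelow bound) (pairsBelow bound) (pairsBelow-unique bound) (pairsBelow-unique bound)
    (λ {p} → TwoSquares⊆pairsBelow {p} ∘ proj₁) (λ {p} → TwoSquares⊆pairsBelow {p} ∘ proj₁) swap swap
    (λ { {u , v} (sq@(eq , _) , odd-u) → TwoSquares-swap {u , v} sq , λ odd-v → not-both-odd eq odd-u odd-v })
    (λ { {u , v} (sq@(eq , _) , ¬odd-u) → TwoSquares-swap {u , v} sq , other-odd eq ¬odd-u })
    (λ _ → refl) (λ _ → refl) (λ _ → 1)
    where
    not-both-odd : ∀ {u v} → u * u + v * v ≡ m → Odd u → ¬ Odd v
    not-both-odd {u} {v} eq odd-u odd-v with sum-of-squares-parity {u} {v} eq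
    ... | inj₁ (_ , even-v) = even⇒¬odd even-v odd-v
    ... | inj₂ (even-u , _) = even⇒¬odd even-u odd-u
    other-odd : ∀ {u v} → u * u + v * v ≡ m → ¬ Odd u → Odd v
    other-odd {u} {v} eq ¬odd-u with sum-of-squares-parity {u} {v} eq
    ... | inj₁ (odd-u , _) = ⊥-elim (¬odd-u odd-u)
    ... | inj₂ (_ , odd-v) = odd-v

  #lowerTwoSquares≡#oddFirst : count₂ (twoSquares? ∩? SwapTwoSquares.Lower?) ≡ count₂ (twoSquares? ∩? oddFirst?)
  #lowerTwoSquares≡#oddFirst = ℕₚ.*-cancelˡ-≡ _ _ 2 (trans (sym by-swap) by-parity)
    where
    no-fixed : ∀ {p} → ¬ (TwoSquares ∩ SwapTwoSquares.Fixed) p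
    no-fixed {u , .u} ((eq , _) , refl) = m≢double (u * u) (sym eq)
    by-swap : count₂ twoSquares? ≡ 2 * count₂ (twoSquares? ∩? SwapTwoSquares.Lower?)
    by-swap = trans (SwapTwoSquares.sumWhere-involution (λ _ → 1))
      (cong₂ _+_ (sumWhere-empty (twoSquares? ∩? SwapTwoSquares.Fixed?) (λ _ → 1) (pairsBelow bound) (λ {p} → no-fixed {p}))
                 (sumWhere-*ˡ (twoSquares? ∩? SwapTwoSquares.Lower?) 2 (λ _ → 1) (pairsBelow bound)))
    by-parity : count₂ twoSquares? ≡ 2 * count₂ (twoSquares? ∩? oddFirst?)
    by-parity = trans (sumWhere-split twoSquares? oddFirst? (λ _ → 1) (pairsBelow bound))
      (trans (cong (_+_ (count₂ (twoSquares? ∩? oddFirst?))) #evenFirst≡#oddFirst)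
             (cong (_+_ (count₂ (twoSquares? ∩? oddFirst?))) (sym (ℕₚ.+-identityʳ _))))

  Zagier : ℕ × (ℕ × ℕ) → Set
  Zagier (x , y , z) = x * x + 4 * (y * z) ≡ m × 1 ≤ y × 1 ≤ z

  zagier? : Decidable Zagier
  zagier? (x , y , z) = (x * x + 4 * (y * z) ≟ m) ×-dec (1 ℕₚ.≤? y) ×-dec (1 ℕₚ.≤? z)

  swapYZ : ℕ × (ℕ × ℕ) → ℕ × (ℕ × ℕ)
  swapYZ (x , y , z) = x , z , y

  Zagier-swapYZ : ∀ {t} → Zagier t → Zagier (swapYZ t)
  Zagier-swapYZ {x , y , z} (eq , 1≤y , 1≤z) = trans (cong (λ w → x * x + 4 * w) (ℕₚ.*-comm z y)) eq , 1≤z , 1≤y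

  Zagier-x-positive : ∀ {x y z} → x * x + 4 * (y * z) ≡ m → 1 ≤ x
  Zagier-x-positive {zero}  {y} {z} eq = ⊥-elim (m≢double (y * z + y * z) (trans (sym eq) (quadruple (y * z))))
    where
    quadruple : ∀ a → 4 * a ≡ (a + a) + (a + a)
    quadruple = solve-∀
  Zagier-x-positive {suc x} eq = s≤s z≤n

  Zagier⊆triplesBelow : ∀ {t} → Zagier t → t ∈ triplesBelow bound
  Zagier⊆triplesBelow {x , y , z} (eq , 1≤y , 1≤z) = ∈-triplesBelow
    (≤2m⇒<bound (ℕₚ.≤-trans (n≤n*n (Zagier-x-positive {x} {y} {z} eq)) (ℕₚ.m≤m+n (x * x) _)) sum≤2m)
    (≤2m⇒<bound (ℕₚ.≤-trans (ℕₚ.m≤m*n y z ⦃ ≥1⇒nonZero 1≤z ⦄) yz≤sum) sum≤2m)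
    (≤2m⇒<bound (ℕₚ.≤-trans (ℕₚ.m≤n*m z y ⦃ ≥1⇒nonZero 1≤y ⦄) yz≤sum) sum≤2m)
    where
    sum≤2m = ℕₚ.≤-trans (ℕₚ.≤-reflexive eq) (ℕₚ.m≤m+n m m)
    yz≤sum = ℕₚ.≤-trans (ℕₚ.m≤n*m (y * z) 4) (ℕₚ.m≤n+m (4 * (y * z)) (x * x))
    ≥1⇒nonZero : ∀ {k} → 1 ≤ k → ℕ.NonZero k
    ≥1⇒nonZero {suc k} _ = _

  module SwapYZ = Involution <lex₃-compare zagier? swapYZ (λ {t} → Zagier-swapYZ {t}) (λ _ → refl)
                             (triplesBelow bound) (triplesBelow-unique bound) (λ {t} → Zagier⊆triplesBelow {t})

  -- x² + 4y² = x² + (2y)² matches the triples with y = z to the sums of two squares with an odd first term.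
  #zagierDiagonal≡#oddFirst : count₂ (twoSquares? ∩? oddFirst?) ≡ count₃ (zagier? ∩? SwapYZ.Fixed?)
  #zagierDiagonal≡#oddFirst = sumWhere-bijection (zagier? ∩? SwapYZ.Fixed?) (twoSquares? ∩? oddFirst?)
    (triplesBelow bound) (pairsBelow bound) (triplesBelow-unique bound) (pairsBelow-unique bound)
    (λ {t} → Zagier⊆triplesBelow {t} ∘ proj₁) (λ {p} → TwoSquares⊆pairsBelow {p} ∘ proj₁)
    double-y halve-v double-y-maps halve-v-maps (λ {t} → halve∘double {t}) (λ {p} → double∘halve {p}) (λ _ → 1)
    where
    double-y : ℕ × (ℕ × ℕ) → ℕ × ℕ
    double-y (x , y , _) = x , y + y
    halve-v : ℕ × ℕ → ℕ × (ℕ × ℕ)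
    halve-v (u , v) = u , ⌊ v /2⌋ , ⌊ v /2⌋
    square-double : ∀ x y → x * x + (y + y) * (y + y) ≡ x * x + 4 * (y * y)
    square-double = solve-∀
    double-y-maps : ∀ {t} → (Zagier ∩ SwapYZ.Fixed) t → (TwoSquares ∩ OddFirst) (double-y t)
    double-y-maps {x , y , .y} ((eq , 1≤y , _) , refl) =
      (two-squares , Zagier-x-positive {x} {y} {y} eq , ℕₚ.≤-trans 1≤y (ℕₚ.m≤m+n y y)) , odd-x
      where
      two-squares = trans (square-double x y) eq
      odd-x : Odd x
      odd-x with sum-of-squares-parity {x} {y + y} two-squares
      ... | inj₁ (odd , _) = odd
      ... | inj₂ (_ , odd) = ⊥-elim (even⇒¬odd (y , refl) odd)
    halve-v-maps : ∀ {p} → (TwoSquares ∩ OddFirst) p → (Zagier ∩ SwapYZ.Fixed) (halve-v p)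
    halve-v-maps {u , v} ((eq , _ , 1≤v) , odd-u) with sum-of-squares-parity {u} {v} eq
    ... | inj₂ (even-u , _)      = ⊥-elim (even⇒¬odd even-u odd-u)
    ... | inj₁ (_ , (k , refl)) = subst (Zagier ∩ SwapYZ.Fixed) (cong (λ h → u , h , h) (ℕₚ.n≡⌊n+n/2⌋ k))
                                        ((trans (sym (square-double u k)) eq , 1≤k , 1≤k) , refl)
      where
      1≤k : 1 ≤ k
      1≤k = positive k 1≤v
        where
        positive : ∀ k → 1 ≤ k + k → 1 ≤ k
        positive (suc _) _ = s≤s z≤n
    halve∘double : ∀ {t} → (Zagier ∩ SwapYZ.Fixed) t → halve-v (double-y t) ≡ t
    halve∘double {x , y , .y} (_ , refl) = cong (λ h → x , h , h) (sym (ℕₚ.n≡⌊n+n/2⌋ y))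
    double∘halve : ∀ {p} → (TwoSquares ∩ OddFirst) p → double-y (halve-v p) ≡ p
    double∘halve {u , v} ((eq , _) , odd-u) with sum-of-squares-parity {u} {v} eq
    ... | inj₂ (even-u , _)      = ⊥-elim (even⇒¬odd even-u odd-u)
    ... | inj₁ (_ , (k , refl)) = cong (λ h → u , h + h) (sym (ℕₚ.n≡⌊n+n/2⌋ k))

  #oddSquares≡diagonal+2#zagierDiagonal :
    count₂ oddSquares? ≡ count₂ (oddSquares? ∩? SwapOddSquares.Fixed?) + 2 * count₃ (zagier? ∩? SwapYZ.Fixed?)
  #oddSquares≡diagonal+2#zagierDiagonal = begin
    count₂ oddSquares?
      ≡⟨ SwapOddSquares.sumWhere-involution (λ _ → 1) ⟩
    count₂ (oddSquares? ∩? SwapOddSquares.Fixed?) + sumWhere (oddSquares? ∩? SwapOddSquares.Lower?) (λ _ → 2) (pairsBelow bound)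
      ≡⟨ cong (_+_ (count₂ (oddSquares? ∩? SwapOddSquares.Fixed?)))
              (sumWhere-*ˡ (oddSquares? ∩? SwapOddSquares.Lower?) 2 (λ _ → 1) (pairsBelow bound)) ⟩
    count₂ (oddSquares? ∩? SwapOddSquares.Fixed?) + 2 * count₂ (oddSquares? ∩? SwapOddSquares.Lower?)
      ≡⟨ cong (λ n → count₂ (oddSquares? ∩? SwapOddSquares.Fixed?) + 2 * n)
              (trans #lowerOddSquares≡#lowerTwoSquares (trans #lowerTwoSquares≡#oddFirst #zagierDiagonal≡#oddFirst)) ⟩
    count₂ (oddSquares? ∩? SwapOddSquares.Fixed?) + 2 * count₃ (zagier? ∩? SwapYZ.Fixed?) ∎
    where open ≡-Reasoning

  Boundary : ℕ × (ℕ × ℕ) → Set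
  Boundary (x , y , z) = x + z ≡ y

  boundary? : Decidable Boundary
  boundary? (x , y , z) = x + z ≟ y

  Regular : ℕ × (ℕ × ℕ) → Set
  Regular = Zagier ∩ ∁ Boundary

  regular? : Decidable Regular
  regular? = zagier? ∩? ∁? boundary?

  -- Zagier's windmill involution; its formulas degenerate exactly on the boundary y = x + z.
  windmill : ℕ × (ℕ × ℕ) → ℕ × (ℕ × ℕ)
  windmill (x , y , z) with x + z ℕₚ.<? y
  ... | yes _ = x + (z + z) , z , y ∸ (x + z)
  ... | no _ with x ℕₚ.<? y + y
  ...   | yes _ = y + y ∸ x , y , x + z ∸ y
  ...   | no _  = x ∸ (y + y) , x + z ∸ y , y

  data WindmillRegion (x y z : ℕ) : Set where
    left   : ∀ w → y ≡ x + z + suc w → WindmillRegion x y z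
    middle : ∀ a r → y + y ≡ x + suc a → x + z ≡ y + suc r → WindmillRegion x y z
    right  : ∀ a r → x ≡ y + y + suc a → x + z ≡ y + suc r → WindmillRegion x y z

  x≢y+y : ∀ {x y z} → x * x + 4 * (y * z) ≡ m → x ≢ y + y
  x≢y+y {x} {y} {z} eq refl = m≢double (y * y + y * z + (y * y + y * z)) (trans (sym eq) (expand y z))
    where
    expand : ∀ y z → (y + y) * (y + y) + 4 * (y * z) ≡ y * y + y * z + (y * y + y * z) + (y * y + y * z + (y * y + y * z))
    expand = solve-∀

  region : ∀ {x y z} → Regular (x , y , z) → WindmillRegion x y z
  region {x} {y} {z} ((eq , _) , x+z≢y) with x + z ℕₚ.<? y
  ... | yes x+z<y = let w , y≡ = <⇒∃+suc x+z<y in left w y≡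
  ... | no x+z≮y with <⇒∃+suc (ℕₚ.≤∧≢⇒< (ℕₚ.≮⇒≥ x+z≮y) (x+z≢y ∘ sym)) | x ℕₚ.<? y + y
  ...   | r , x+z≡ | yes x<2y = let a , 2y≡ = <⇒∃+suc x<2y in middle a r 2y≡ x+z≡
  ...   | r , x+z≡ | no x≮2y  =
    let a , x≡ = <⇒∃+suc (ℕₚ.≤∧≢⇒< (ℕₚ.≮⇒≥ x≮2y) (x≢y+y {x} {y} {z} eq ∘ sym)) in right a r x≡ x+z≡

  windmill-left : ∀ x z w → windmill (x , x + z + suc w , z) ≡ (x + (z + z) , z , suc w)
  windmill-left x z w with x + z ℕₚ.<? x + z + suc w
  ... | yes _ = cong (λ k → x + (z + z) , z , k) (ℕₚ.m+n∸m≡n (x + z) (suc w))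
  ... | no ¬< = ⊥-elim (¬< (ℕₚ.m<m+n (x + z) (s≤s z≤n)))

  windmill-middle : ∀ {x y z a r} → y + y ≡ x + suc a → x + z ≡ y + suc r → windmill (x , y , z) ≡ (suc a , y , suc r)
  windmill-middle {x} {y} {z} {a} {r} 2y≡ x+z≡ with x + z ℕₚ.<? y
  ... | yes x+z<y = ⊥-elim (ℕₚ.<-irrefl refl (ℕₚ.<-≤-trans x+z<y (subst (y ≤_) (sym x+z≡) (ℕₚ.m≤m+n y (suc r)))))
  ... | no _ with x ℕₚ.<? y + y
  ...   | yes _   = cong₂ (λ p q → p , y , q) (trans (cong (_∸ x) 2y≡) (ℕₚ.m+n∸m≡n x (suc a)))
                                            (trans (cong (_∸ y) x+z≡) (ℕₚ.m+n∸m≡n y (suc r)))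
  ...   | no x≮2y = ⊥-elim (x≮2y (subst (x <_) (sym 2y≡) (ℕₚ.m<m+n x (s≤s z≤n))))

  windmill-right : ∀ {y z a r} → y + y + suc a + z ≡ y + suc r → windmill (y + y + suc a , y , z) ≡ (suc a , suc r , y)
  windmill-right {y} {z} {a} {r} x+z≡ with y + y + suc a + z ℕₚ.<? y
  ... | yes x+z<y =
    ⊥-elim (ℕₚ.<-irrefl refl (ℕₚ.<-≤-trans x+z<y (ℕₚ.≤-trans (ℕₚ.m≤m+n y (y + suc a + z)) (ℕₚ.≤-reflexive (assoc y a z)))))
    where
    assoc : ∀ y a z → y + (y + suc a + z) ≡ y + y + suc a + z
    assoc = solve-∀
  ... | no _ with y + y + suc a ℕₚ.<? y + y
  ...   | yes x<2y = ⊥-elim (ℕₚ.<-irrefl refl (ℕₚ.<-≤-trans x<2y (ℕₚ.m≤m+n (y + y) (suc a))))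
  ...   | no _     = cong₂ (λ p q → p , q , y) (ℕₚ.m+n∸m≡n (y + y) (suc a)) (trans (cong (_∸ y) x+z≡) (ℕₚ.m+n∸m≡n y (suc r)))

  -- a² + 4yr + X ≡ x² + 4yz + X′ is a semiring identity, and X′ ≡ X by the two hypotheses.
  middle-image : ∀ {x y z a r} → y + y ≡ x + a → x + z ≡ y + r → x * x + 4 * (y * z) ≡ m → a * a + 4 * (y * r) ≡ m
  middle-image {x} {y} {z} {a} {r} 2y≡ x+z≡ eq =
    trans (ℕₚ.+-cancelʳ-≡ X _ _ (trans (identity x y z a r) (cong (_+_ (x * x + 4 * (y * z))) X′≡X))) eq
    where
    X  = (a + (y + y)) * (y + y) + x * (x + a) + 4 * y * (x + z)
    X′ = (a + (y + y)) * (x + a) + x * (y + y) + 4 * y * (y + r)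
    identity : ∀ x y z a r → a * a + 4 * (y * r) + ((a + (y + y)) * (y + y) + x * (x + a) + 4 * y * (x + z))
                           ≡ x * x + 4 * (y * z) + ((a + (y + y)) * (x + a) + x * (y + y) + 4 * y * (y + r))
    identity = solve-∀
    X′≡X : X′ ≡ X
    X′≡X = cong₂ _+_ (cong₂ _+_ (cong ((a + (y + y)) *_) (sym 2y≡)) (cong (x *_) 2y≡)) (cong (4 * y *_) (sym x+z≡))

  middle-sum : ∀ {x y z a r} → y + y ≡ x + a → x + z ≡ y + r → a + r ≡ y + z
  middle-sum {x} {y} {z} {a} {r} 2y≡ x+z≡ =
    ℕₚ.+-cancelʳ-≡ (x + y) _ _ (trans (regroup₁ a r x y) (trans (cong₂ _+_ (sym 2y≡) (sym x+z≡)) (regroup₂ y z x)))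
    where
    regroup₁ : ∀ a r x y → a + r + (x + y) ≡ (x + a) + (y + r)
    regroup₁ = solve-∀
    regroup₂ : ∀ y z x → (y + y) + (x + z) ≡ y + z + (x + y)
    regroup₂ = solve-∀

  right-middle : ∀ {y z a r} → y + y + suc a + z ≡ y + suc r → suc r ≡ y + suc a + z
  right-middle {y} {z} {a} {r} x+z≡ = sym (ℕₚ.+-cancelˡ-≡ y _ _ (trans (regroup y a z) x+z≡))
    where
    regroup : ∀ y a z → y + (y + suc a + z) ≡ y + y + suc a + z
    regroup = solve-∀

  windmill-closed : ∀ {t} → Regular t → Regular (windmill t)
  windmill-closed {x , y , z} reg@((eq , 1≤y , 1≤z) , _) with region reg
  ... | left w refl = subst Regular (sym (windmill-left x z w)) ((trans (expand x z w) eq , 1≤z , s≤s z≤n) , not-boundary)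
    where
    expand : ∀ x z w → (x + (z + z)) * (x + (z + z)) + 4 * (z * suc w) ≡ x * x + 4 * ((x + z + suc w) * z)
    expand = solve-∀
    regroup : ∀ x z w → x + z + (z + suc w) ≡ x + (z + z) + suc w
    regroup = solve-∀
    not-boundary : x + (z + z) + suc w ≢ z
    not-boundary eq′ = ℕₚ.<-irrefl (sym eq′) (ℕₚ.<-≤-trans (ℕₚ.m<m+n z (s≤s z≤n))
                         (ℕₚ.≤-trans (ℕₚ.m≤n+m (z + suc w) (x + z)) (ℕₚ.≤-reflexive (regroup x z w))))
  ... | middle a r 2y≡ x+z≡ =
    subst Regular (sym (windmill-middle 2y≡ x+z≡)) ((middle-image {x} {y} {z} 2y≡ x+z≡ eq , 1≤y , s≤s z≤n) , not-boundary)
    where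
    not-boundary : suc a + suc r ≢ y
    not-boundary eq′ = ℕₚ.<-irrefl (trans (sym eq′) (middle-sum {x} {y} {z} 2y≡ x+z≡)) (ℕₚ.m<m+n y 1≤z)
  ... | right a r refl x+z≡ = subst Regular (sym (windmill-right x+z≡)) ((image-eq , s≤s z≤n , 1≤y) , not-boundary)
    where
    expand : ∀ y a z → suc a * suc a + 4 * ((y + suc a + z) * y) ≡ (y + y + suc a) * (y + y + suc a) + 4 * (y * z)
    expand = solve-∀
    image-eq : suc a * suc a + 4 * (suc r * y) ≡ m
    image-eq = trans (cong (λ k → suc a * suc a + 4 * (k * y)) (right-middle {y} {z} x+z≡)) (trans (expand y a z) eq)
    regroup : ∀ y a z → y + suc a + z ≡ suc a + y + z
    regroup = solve-∀
    not-boundary : suc a + y ≢ suc r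
    not-boundary eq′ = ℕₚ.<-irrefl (trans (trans eq′ (right-middle {y} {z} x+z≡)) (regroup y a z)) (ℕₚ.m<m+n (suc a + y) 1≤z)

  windmill-involutive : ∀ {t} → Regular t → windmill (windmill t) ≡ t
  windmill-involutive {x , y , z} reg@((eq , _ , 1≤z) , _) with region reg
  ... | left w refl with 1≤⇒≡suc (Zagier-x-positive {x} {x + z + suc w} {z} eq)
  ...   | x′ , refl = trans (cong windmill (windmill-left (suc x′) z w))
                             (trans (cong (λ k → windmill (k , z , suc w)) (regroup₁ x′ z))
                                    (windmill-right {z} {suc w} {x′} {x′ + z + suc w} (regroup₂ x′ z w)))
    where
    regroup₁ : ∀ x′ z → suc x′ + (z + z) ≡ z + z + suc x′
    regroup₁ = solve-∀
    regroup₂ : ∀ x′ z w → z + z + suc x′ + suc w ≡ z + suc (x′ + z + suc w)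
    regroup₂ = solve-∀
  windmill-involutive {x , y , z} reg@((eq , _ , 1≤z) , _) | middle a r 2y≡ x+z≡
    with 1≤⇒≡suc (Zagier-x-positive {x} {y} {z} eq) | 1≤⇒≡suc 1≤z
  ... | x′ , refl | z′ , refl =
    trans (cong windmill (windmill-middle 2y≡ x+z≡))
          (windmill-middle (trans 2y≡ (ℕₚ.+-comm (suc x′) (suc a))) (middle-sum {suc x′} {y} {suc z′} 2y≡ x+z≡))
  windmill-involutive {x , y , z} reg@((eq , _ , 1≤z) , _) | right a r refl x+z≡ with 1≤⇒≡suc 1≤z
  ... | z′ , refl =
    trans (cong windmill (trans (windmill-right x+z≡) (cong (λ k → suc a , k , y) (trans (right-middle {y} {suc z′} x+z≡) (regroup₁ y a (suc z′))))))
          (trans (windmill-left (suc a) y z′) (cong (λ k → k , y , suc z′) (regroup₂ a y)))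
    where
    regroup₁ : ∀ y a z → y + suc a + z ≡ suc a + y + z
    regroup₁ = solve-∀
    regroup₂ : ∀ a y → suc a + (y + y) ≡ y + y + suc a
    regroup₂ = solve-∀

  windmill-fixed⇒x≡y : ∀ {x y z} → Regular (x , y , z) → windmill (x , y , z) ≡ (x , y , z) → x ≡ y
  windmill-fixed⇒x≡y {x} {y} {z} reg@((_ , 1≤y , 1≤z) , _) fixed with region reg
  ... | left w refl = ⊥-elim (ℕₚ.<-irrefl (sym (cong proj₁ (trans (sym (windmill-left x z w)) fixed)))
                                          (ℕₚ.m<m+n x (ℕₚ.<-≤-trans 1≤z (ℕₚ.m≤m+n z z))))
  ... | middle a r 2y≡ x+z≡ = sym (double-injective (trans 2y≡ (cong (_+_ x) (cong proj₁ (trans (sym (windmill-middle 2y≡ x+z≡)) fixed)))))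
  ... | right a r refl x+z≡ = ⊥-elim (ℕₚ.<-irrefl (cong proj₁ (trans (sym (windmill-right x+z≡)) fixed))
                                                  (ℕₚ.m<n+m (suc a) (ℕₚ.<-≤-trans 1≤y (ℕₚ.m≤m+n y y))))

  windmill-fixes-x≡y : ∀ {x z} → Regular (x , x , z) → windmill (x , x , z) ≡ (x , x , z)
  windmill-fixes-x≡y {x} {z} ((eq , 1≤x , 1≤z) , _) with 1≤⇒≡suc 1≤x | 1≤⇒≡suc 1≤z
  ... | x′ , refl | z′ , refl = windmill-middle {suc x′} {suc x′} {suc z′} {x′} {z′} refl refl

  Regular⊆triplesBelow : ∀ {t} → Regular t → t ∈ triplesBelow bound
  Regular⊆triplesBelow {t} = Zagier⊆triplesBelow {t} ∘ proj₁

  module Windmill = Involution <lex₃-compare regular? windmill (λ {t} → windmill-closed {t}) (λ {t} → windmill-involutive {t})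
                               (triplesBelow bound) (triplesBelow-unique bound) (λ {t} → Regular⊆triplesBelow {t})

  -- Both involutions pair up the triples, so their fixed-point counts agree mod 2.
  #zagierDiagonal≡#boundary+#windmillFixed-mod2 : ∃ λ X → ∃ λ Y →
    count₃ (zagier? ∩? SwapYZ.Fixed?) + 2 * X ≡ count₃ (zagier? ∩? boundary?) + (count₃ (regular? ∩? Windmill.Fixed?) + 2 * Y)
  #zagierDiagonal≡#boundary+#windmillFixed-mod2 =
    count₃ (zagier? ∩? SwapYZ.Lower?) , count₃ (regular? ∩? Windmill.Lower?) , (begin
      count₃ (zagier? ∩? SwapYZ.Fixed?) + 2 * count₃ (zagier? ∩? SwapYZ.Lower?)
        ≡⟨ cong (_+_ (count₃ (zagier? ∩? SwapYZ.Fixed?))) (sumWhere-*ˡ (zagier? ∩? SwapYZ.Lower?) 2 (λ _ → 1) (triplesBelow bound)) ⟨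
      count₃ (zagier? ∩? SwapYZ.Fixed?) + sumWhere (zagier? ∩? SwapYZ.Lower?) (λ _ → 2) (triplesBelow bound)
        ≡⟨ SwapYZ.sumWhere-involution (λ _ → 1) ⟨
      count₃ zagier?
        ≡⟨ sumWhere-split zagier? boundary? (λ _ → 1) (triplesBelow bound) ⟩
      count₃ (zagier? ∩? boundary?) + count₃ regular?
        ≡⟨ cong (_+_ (count₃ (zagier? ∩? boundary?))) (Windmill.sumWhere-involution (λ _ → 1)) ⟩
      count₃ (zagier? ∩? boundary?) + (count₃ (regular? ∩? Windmill.Fixed?) + sumWhere (regular? ∩? Windmill.Lower?) (λ _ → 2) (triplesBelow bound))
        ≡⟨ cong (λ n → count₃ (zagier? ∩? boundary?) + (count₃ (regular? ∩? Windmill.Fixed?) + n))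
                (sumWhere-*ˡ (regular? ∩? Windmill.Lower?) 2 (λ _ → 1) (triplesBelow bound)) ⟩
      count₃ (zagier? ∩? boundary?) + (count₃ (regular? ∩? Windmill.Fixed?) + 2 * count₃ (regular? ∩? Windmill.Lower?)) ∎)
    where open ≡-Reasoning

  1≤m : 1 ≤ m
  1≤m = subst (1 ≤_) (sym (proj₂ m-odd)) (s≤s z≤n)

  DivisorPair : ℕ × ℕ → Set
  DivisorPair (d , e) = d * e ≡ m

  divisorPair? : Decidable DivisorPair
  divisorPair? (d , e) = d * e ≟ m

  DivisorPair-1≤ : ∀ {d e} → d * e ≡ m → 1 ≤ d
  DivisorPair-1≤ {zero}  eq = ⊥-elim (ℕₚ.<-irrefl eq 1≤m)
  DivisorPair-1≤ {suc d} eq = s≤s z≤n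

  DivisorPair-swap : ∀ {p} → DivisorPair p → DivisorPair (swap p)
  DivisorPair-swap {d , e} eq = trans (ℕₚ.*-comm e d) eq

  DivisorPair⊆pairsBelow : ∀ {p} → DivisorPair p → p ∈ pairsBelow bound
  DivisorPair⊆pairsBelow {d , e} eq = ∈-pairsBelow
    (≤2m⇒<bound (ℕₚ.m≤m*n d e ⦃ nonZero (DivisorPair-1≤ {e} {d} (DivisorPair-swap {d , e} eq)) ⦄) m≤2m)
    (≤2m⇒<bound (ℕₚ.m≤n*m e d ⦃ nonZero (DivisorPair-1≤ {d} {e} eq) ⦄) m≤2m)
    where
    m≤2m = ℕₚ.≤-trans (ℕₚ.≤-reflexive eq) (ℕₚ.m≤m+n m m)
    nonZero : ∀ {k} → 1 ≤ k → ℕ.NonZero k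
    nonZero {suc k} _ = _

  module SwapDivisors = Involution <lex-compare divisorPair? swap (λ {p} → DivisorPair-swap {p}) (λ _ → refl)
                                   (pairsBelow bound) (pairsBelow-unique bound) (λ {p} → DivisorPair⊆pairsBelow {p})

  σ₁-as-sumWhere : σ₁ m ≡ sumWhere divisorPair? proj₁ (pairsBelow bound)
  σ₁-as-sumWhere = begin
    σ₁ m                                                        ≡⟨ cong sum (map-id (filter (_∣? m) (map suc (upTo m)))) ⟨
    sumWhere (_∣? m) (λ d → d) (map suc (upTo m))               ≡⟨ sumWhere-bijection (_∣? m) divisorPair? (map suc (upTo m)) (pairsBelow bound)
                                                                     (map⁺ ℕₚ.suc-injective (upTo⁺ m)) (pairsBelow-unique bound)
                                                                     ∣m⇒∈ (λ {p} → DivisorPair⊆pairsBelow {p}) (λ d → d , m / d) proj₁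
                                                                     with-cofactor divides-m (λ _ → refl) cofactor≡ proj₁ ⟨
    sumWhere divisorPair? proj₁ (pairsBelow bound)              ∎
    where
    open ≡-Reasoning
    _/_ : ℕ → ℕ → ℕ
    n / zero  = 0
    n / suc d = n ℕ./ suc d
    ∣m⇒∈ : ∀ {d} → d ∣ m → d ∈ map suc (upTo m)
    ∣m⇒∈ {zero}  0∣m = ⊥-elim (ℕₚ.<-irrefl (sym (0∣⇒≡0 0∣m)) 1≤m)
    ∣m⇒∈ {suc d} d∣m = ∈-map⁺ suc (∈-upTo⁺ (∣⇒≤ ⦃ ℕ.>-nonZero 1≤m ⦄ d∣m))
    with-cofactor : ∀ {d} → d ∣ m → DivisorPair (d , m / d)
    with-cofactor {zero}  0∣m = ⊥-elim (ℕₚ.<-irrefl (sym (0∣⇒≡0 0∣m)) 1≤m)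
    with-cofactor {suc d} (divides q eq) =
      trans (cong (λ k → suc d * (k / suc d)) eq) (trans (cong (suc d *_) (m*n/n≡m q (suc d))) (trans (ℕₚ.*-comm (suc d) q) (sym eq)))
    divides-m : ∀ {p} → DivisorPair p → proj₁ p ∣ m
    divides-m {d , e} eq = divides e (trans (sym eq) (ℕₚ.*-comm d e))
    cofactor≡ : ∀ {p} → DivisorPair p → (proj₁ p , m / proj₁ p) ≡ p
    cofactor≡ {zero , e} eq = ⊥-elim (ℕₚ.<-irrefl eq 1≤m)
    cofactor≡ {suc d , e} eq = cong (suc d ,_) (trans (cong (ℕ._/ suc d) (trans (sym eq) (ℕₚ.*-comm (suc d) e))) (m*n/n≡m e (suc d)))

  FourDividesGap : ℕ × ℕ → Set
  FourDividesGap (d , e) = 4 ∣ e ∸ d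

  fourDividesGap? : Decidable FourDividesGap
  fourDividesGap? (d , e) = 4 ∣? e ∸ d

  LowerDivisorPair = DivisorPair ∩ SwapDivisors.Lower
  lowerDivisorPair? = divisorPair? ∩? SwapDivisors.Lower?

  lower-divisor-pair-shape : ∀ {d e} → d * e ≡ m → d < e → ∃ λ a → ∃ λ c → d ≡ suc (a + a) × e ≡ d + (c + c)
  lower-divisor-pair-shape {d} {e} eq d<e with <⇒∃+suc d<e | even-or-odd d | even-or-odd e
  ... | _ , _    | inj₁ even-d | _          = ⊥-elim (even⇒¬odd (subst Even eq (even*ˡ e even-d)) m-odd)
  ... | _ , _    | _          | inj₁ even-e = ⊥-elim (even⇒¬odd (subst Even (trans (ℕₚ.*-comm e d) eq) (even*ˡ d even-e)) m-odd)
  ... | g , refl | inj₂ (a , refl) | inj₂ odd-e with even-or-odd (suc g)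
  ...   | inj₁ (c , g≡) = a , c , refl , cong (_+_ (suc (a + a))) g≡
  ...   | inj₂ odd-g    = ⊥-elim (even⇒¬odd (odd+odd (a , refl) odd-g) odd-e)

  ≡+4*⇒≡-mod4 : ∀ {n r} k → n ≡ r + 4 * k → + n ≡ + r [mod + 4 ]
  ≡+4*⇒≡-mod4 {n} {r} k eq = a+k*x≡b+k*y⇒a≡b-mod {x = 0} {y = k} 4 (trans (ℕₚ.+-identityʳ n) eq)

  lower-pair-sum-gap4 : ∀ {d e} → d * e ≡ m → d < e → FourDividesGap (d , e) → + (d + e) ≡ + 2 [mod + 4 ]
  lower-pair-sum-gap4 eq d<e gap4 with lower-divisor-pair-shape eq d<e
  ... | a , c , refl , refl with subst (4 ∣_) (ℕₚ.m+n∸m≡n (suc (a + a)) (c + c)) gap4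
  ...   | divides q c+c≡q*4 = ≡+4*⇒≡-mod4 (a + q) (trans (regroup₁ a c) (trans (cong (λ k → 2 + 4 * a + k + k) c≡q+q) (regroup₂ a q)))
    where
    c≡q+q : c ≡ q + q
    c≡q+q = double-injective (trans c+c≡q*4 (quadruple q))
      where
      quadruple : ∀ q → q * 4 ≡ (q + q) + (q + q)
      quadruple = solve-∀
    regroup₁ : ∀ a c → suc (a + a) + (suc (a + a) + (c + c)) ≡ 2 + 4 * a + c + c
    regroup₁ = solve-∀
    regroup₂ : ∀ a q → 2 + 4 * a + (q + q) + (q + q) ≡ 2 + 4 * (a + q)
    regroup₂ = solve-∀

  lower-pair-sum-no-gap4 : ∀ {d e} → d * e ≡ m → d < e → ¬ FourDividesGap (d , e) → + (d + e) ≡ + 0 [mod + 4 ]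
  lower-pair-sum-no-gap4 eq d<e ¬gap4 with lower-divisor-pair-shape eq d<e
  ... | a , c , refl , refl with even-or-odd c
  ...   | inj₁ (j , refl) = ⊥-elim (¬gap4 (subst (4 ∣_) (sym (ℕₚ.m+n∸m≡n (suc (a + a)) ((j + j) + (j + j)))) (divides j (quadruple j))))
    where
    quadruple : ∀ j → (j + j) + (j + j) ≡ j * 4
    quadruple = solve-∀
  ...   | inj₂ (j , refl) = ≡+4*⇒≡-mod4 (a + j + 1) (regroup a j)
    where
    regroup : ∀ a j → suc (a + a) + (suc (a + a) + (suc (j + j) + suc (j + j))) ≡ 0 + 4 * (a + j + 1)
    regroup = solve-∀

  σ₁-mod4 : + σ₁ m ≡ + (sumWhere (divisorPair? ∩? SwapDivisors.Fixed?) proj₁ (pairsBelow bound)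
                       + 2 * count₂ (lowerDivisorPair? ∩? fourDividesGap?)) [mod + 4 ]
  σ₁-mod4 = subst₂ (_≡_[mod + 4 ]) (cong +_ (sym σ₁≡)) (cong +_ (cong (_+_ Σsquare) (trans (cong₂ _+_ 2G≡ S₀≡0) (ℕₚ.+-identityʳ _))))
              (embed {Σsquare} {A₁} {A₂} {Σsquare} {S₂} {S₀} (+-mod (≡⇒≡-mod {+ Σsquare} refl) (+-mod gap4 no-gap4)))
    where
    Σsquare = sumWhere (divisorPair? ∩? SwapDivisors.Fixed?) proj₁ (pairsBelow bound)
    pair-sum : ℕ × ℕ → ℕ
    pair-sum (d , e) = d + e
    A₁ = sumWhere (lowerDivisorPair? ∩? fourDividesGap?) pair-sum (pairsBelow bound)
    A₂ = sumWhere (lowerDivisorPair? ∩? ∁? fourDividesGap?) pair-sum (pairsBelow bound)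
    σ₁≡ : σ₁ m ≡ Σsquare + (A₁ + A₂)
    σ₁≡ = trans σ₁-as-sumWhere (trans (SwapDivisors.sumWhere-involution proj₁)
                                      (cong (_+_ Σsquare) (sumWhere-split lowerDivisorPair? fourDividesGap? pair-sum (pairsBelow bound))))
    gap4 = sumWhere-mod (lowerDivisorPair? ∩? fourDividesGap?) pair-sum (λ _ → 2) (pairsBelow bound)
             (λ { {d , e} ((eq , lower) , g) → lower-pair-sum-gap4 eq (swap-<lex lower) g })
    no-gap4 = sumWhere-mod (lowerDivisorPair? ∩? ∁? fourDividesGap?) pair-sum (λ _ → 0) (pairsBelow bound)
                (λ { {d , e} ((eq , lower) , ¬g) → lower-pair-sum-no-gap4 eq (swap-<lex lower) ¬g })
    2G≡ : sumWhere (lowerDivisorPair? ∩? fourDividesGap?) (λ _ → 2) (pairsBelow bound) ≡ 2 * count₂ (lowerDivisorPair? ∩? fourDividesGap?)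
    2G≡ = sumWhere-*ˡ (lowerDivisorPair? ∩? fourDividesGap?) 2 (λ _ → 1) (pairsBelow bound)
    S₂ = sumWhere (lowerDivisorPair? ∩? fourDividesGap?) (λ _ → 2) (pairsBelow bound)
    S₀ = sumWhere (lowerDivisorPair? ∩? ∁? fourDividesGap?) (λ _ → 0) (pairsBelow bound)
    S₀≡0 : sumWhere (lowerDivisorPair? ∩? ∁? fourDividesGap?) (λ _ → 0) (pairsBelow bound) ≡ 0
    S₀≡0 = sumWhere-*ˡ (lowerDivisorPair? ∩? ∁? fourDividesGap?) 0 (λ _ → 1) (pairsBelow bound)
    embed : ∀ {a b c a′ b′ c′} → + a ℤ.+ (+ b ℤ.+ + c) ≡ + a′ ℤ.+ (+ b′ ℤ.+ + c′) [mod + 4 ] →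
            + (a + (b + c)) ≡ + (a′ + (b′ + c′)) [mod + 4 ]
    embed {a} {b} {c} {a′} {b′} {c′} = subst₂ (_≡_[mod + 4 ]) (sym (lift a b c)) (sym (lift a′ b′ c′))
      where
      lift : ∀ a b c → + (a + (b + c)) ≡ + a ℤ.+ (+ b ℤ.+ + c)
      lift a b c = trans (ℤₚ.pos-+ a (b + c)) (cong (ℤ._+_ (+ a)) (ℤₚ.pos-+ b c))

  -- A windmill fixed point (x , x , z) is the factorisation m = x (x + 4z).
  #windmillFixed≡#lowerDivisorPairs : count₃ (regular? ∩? Windmill.Fixed?) ≡ count₂ (lowerDivisorPair? ∩? fourDividesGap?)
  #windmillFixed≡#lowerDivisorPairs = sym (sumWhere-bijection (regular? ∩? Windmill.Fixed?) (lowerDivisorPair? ∩? fourDividesGap?)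
    (triplesBelow bound) (pairsBelow bound) (triplesBelow-unique bound) (pairsBelow-unique bound)
    (λ {t} → Regular⊆triplesBelow {t} ∘ proj₁) (λ {p} → DivisorPair⊆pairsBelow {p} ∘ proj₁ ∘ proj₁)
    factor unfactor factor-maps unfactor-maps (λ {t} → unfactor∘factor {t}) (λ {p} → factor∘unfactor {p}) (λ _ → 1))
    where
    factor : ℕ × (ℕ × ℕ) → ℕ × ℕ
    factor (x , _ , z) = x , x + 4 * z
    unfactor : ℕ × ℕ → ℕ × (ℕ × ℕ)
    unfactor (d , e) = d , d , (e ∸ d) ℕ./ 4
    factor-maps : ∀ {t} → (Regular ∩ Windmill.Fixed) t → (LowerDivisorPair ∩ FourDividesGap) (factor t)
    factor-maps {x , y , z} (reg@((eq , _ , 1≤z) , _) , fixed) with windmill-fixed⇒x≡y reg fixed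
    ... | refl = (trans (expand x z) eq , inj₁ (ℕₚ.m<m+n x (ℕₚ.<-≤-trans 1≤z (ℕₚ.m≤n*m z 4))))
               , subst (4 ∣_) (sym (ℕₚ.m+n∸m≡n x (4 * z))) (divides z (ℕₚ.*-comm 4 z))
      where
      expand : ∀ x z → x * (x + 4 * z) ≡ x * x + 4 * (x * z)
      expand = solve-∀
    unfactor-maps : ∀ {p} → (LowerDivisorPair ∩ FourDividesGap) p → (Regular ∩ Windmill.Fixed) (unfactor p)
    unfactor-maps {d , e} ((eq , lower) , divides q gap≡) =
      subst (λ k → (Regular ∩ Windmill.Fixed) (d , d , k)) (sym (trans (cong (ℕ._/ 4) gap≡) (m*n/n≡m q 4))) (reg , windmill-fixes-x≡y {d} {q} reg)
      where
      d<e = swap-<lex lower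
      e≡ : e ≡ d + q * 4
      e≡ = trans (sym (ℕₚ.m+[n∸m]≡n (ℕₚ.<⇒≤ d<e))) (cong (_+_ d) gap≡)
      1≤q : 1 ≤ q
      1≤q = ℕₚ.n≢0⇒n>0 (λ { refl → ℕₚ.<-irrefl (trans (sym (ℕₚ.+-identityʳ d)) (sym e≡)) d<e })
      expand : ∀ d q → d * d + 4 * (d * q) ≡ d * (d + q * 4)
      expand = solve-∀
      reg : Regular (d , d , q)
      reg = (trans (expand d q) (trans (cong (d *_) (sym e≡)) eq) , DivisorPair-1≤ {d} {e} eq , 1≤q)
          , λ d+q≡d → ℕₚ.<-irrefl (sym d+q≡d) (ℕₚ.m<m+n d 1≤q)
    unfactor∘factor : ∀ {t} → (Regular ∩ Windmill.Fixed) t → unfactor (factor t) ≡ t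
    unfactor∘factor {x , y , z} (reg , fixed) with windmill-fixed⇒x≡y reg fixed
    ... | refl = cong (λ k → x , x , k) (trans (cong (ℕ._/ 4) (trans (ℕₚ.m+n∸m≡n x (4 * z)) (ℕₚ.*-comm 4 z))) (m*n/n≡m z 4))
    factor∘unfactor : ∀ {p} → (LowerDivisorPair ∩ FourDividesGap) p → factor (unfactor p) ≡ p
    factor∘unfactor {d , e} ((_ , lower) , divides q gap≡) = cong (d ,_) (begin
      d + 4 * ((e ∸ d) ℕ./ 4) ≡⟨ cong (λ k → d + 4 * (k ℕ./ 4)) gap≡ ⟩
      d + 4 * (q * 4 ℕ./ 4)   ≡⟨ cong (λ k → d + 4 * k) (m*n/n≡m q 4) ⟩
      d + 4 * q               ≡⟨ cong (_+_ d) (trans (ℕₚ.*-comm 4 q) (sym gap≡)) ⟩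
      d + (e ∸ d)             ≡⟨ ℕₚ.m+[n∸m]≡n (ℕₚ.<⇒≤ (swap-<lex lower)) ⟩
      e                       ∎)
      where open ≡-Reasoning

  square-injective : ∀ {a b} → a * a ≡ b * b → a ≡ b
  square-injective {a} {b} eq with ℕₚ.<-cmp a b
  ... | tri< a<b _ _ = ⊥-elim (ℕₚ.<-irrefl eq (ℕₚ.*-mono-< a<b a<b))
  ... | tri≈ _ a≡b _ = a≡b
  ... | tri> _ _ b<a = ⊥-elim (ℕₚ.<-irrefl (sym eq) (ℕₚ.*-mono-< b<a b<a))

  boundary-square : ∀ x z → x * x + 4 * ((x + z) * z) ≡ (x + (z + z)) * (x + (z + z))
  boundary-square = solve-∀

  module _ (not-square : ∀ s → s * s ≢ m) where

    #oddSquaresDiagonal≡0 : count₂ (oddSquares? ∩? SwapOddSquares.Fixed?) ≡ 0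
    #oddSquaresDiagonal≡0 = sumWhere-empty (oddSquares? ∩? SwapOddSquares.Fixed?) (λ _ → 1) (pairsBelow bound)
      (λ { {a , .a} (eq , refl) → not-square (suc (a + a)) (double-injective eq) })

    #boundary≡0 : count₃ (zagier? ∩? boundary?) ≡ 0
    #boundary≡0 = sumWhere-empty (zagier? ∩? boundary?) (λ _ → 1) (triplesBelow bound)
      (λ { {x , .(x + z) , z} ((eq , _) , refl) → not-square (x + (z + z)) (trans (sym (boundary-square x z)) eq) })

    Σsquare-divisors≡0 : sumWhere (divisorPair? ∩? SwapDivisors.Fixed?) proj₁ (pairsBelow bound) ≡ 0
    Σsquare-divisors≡0 = sumWhere-empty (divisorPair? ∩? SwapDivisors.Fixed?) proj₁ (pairsBelow bound)
      (λ { {d , .d} (eq , refl) → not-square d eq })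

  module _ (r : ℕ) (square : suc (r + r) * suc (r + r) ≡ m) where

    private
      s = suc (r + r)

    #oddSquaresDiagonal≡1 : count₂ (oddSquares? ∩? SwapOddSquares.Fixed?) ≡ 1
    #oddSquaresDiagonal≡1 = sumWhere-singleton (oddSquares? ∩? SwapOddSquares.Fixed?) (λ _ → 1) (pairsBelow bound)
      (pairsBelow-unique bound) (r , r) (OddSquares⊆pairsBelow {r , r} r-r) (r-r , refl) only-r-r
      where
      r-r : OddSquares (r , r)
      r-r = cong₂ _+_ square square
      only-r-r : ∀ {p} → (OddSquares ∩ SwapOddSquares.Fixed) p → p ≡ (r , r)
      only-r-r {a , .a} (eq , refl) =
        cong (λ k → k , k) (double-injective (ℕₚ.suc-injective (square-injective (trans (double-injective eq) (sym square)))))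

    Σsquare-divisors≡s : sumWhere (divisorPair? ∩? SwapDivisors.Fixed?) proj₁ (pairsBelow bound) ≡ s
    Σsquare-divisors≡s = sumWhere-singleton (divisorPair? ∩? SwapDivisors.Fixed?) proj₁ (pairsBelow bound)
      (pairsBelow-unique bound) (s , s) (DivisorPair⊆pairsBelow {s , s} square) (square , refl) only-s-s
      where
      only-s-s : ∀ {p} → (DivisorPair ∩ SwapDivisors.Fixed) p → p ≡ (s , s)
      only-s-s {d , .d} (eq , refl) = cong (λ k → k , k) (square-injective (trans eq (sym square)))

    boundary-point : ℕ → ℕ × (ℕ × ℕ)
    boundary-point i = s ∸ (suc i + suc i) , s ∸ suc i , suc i

    x+2z≡s : ∀ {x z} → x * x + 4 * ((x + z) * z) ≡ m → x + (z + z) ≡ s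
    x+2z≡s {x} {z} eq = square-injective (trans (sym (boundary-square x z)) (trans eq (sym square)))

    boundary-point-maps : ∀ {i} → i < r → (Zagier ∩ Boundary) (boundary-point i)
    boundary-point-maps {i} i<r with <⇒∃+suc i<r
    ... | j , refl = subst (Zagier ∩ Boundary) (sym point≡)
                           ((trans (boundary-square (suc (j + j)) (suc i)) (trans (cong (λ k → k * k) (sym s≡)) square) , s≤s z≤n , s≤s z≤n) , refl)
      where
      regroup : ∀ i j → suc ((i + suc j) + (i + suc j)) ≡ suc (j + j) + (suc i + suc i)
      regroup = solve-∀
      s≡ : s ≡ suc (j + j) + (suc i + suc i)
      s≡ = regroup i j
      point≡ : boundary-point i ≡ (suc (j + j) , suc (j + j) + suc i , suc i)
      point≡ = cong₂ (λ a b → a , b , suc i)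
                 (trans (cong (_∸ (suc i + suc i)) s≡) (ℕₚ.m+n∸n≡m (suc (j + j)) (suc i + suc i)))
                 (trans (cong (_∸ suc i) (trans s≡ (sym (ℕₚ.+-assoc (suc (j + j)) (suc i) (suc i))))) (ℕₚ.m+n∸n≡m (suc (j + j) + suc i) (suc i)))

    boundary-index : ℕ × (ℕ × ℕ) → ℕ
    boundary-index (_ , _ , z) = ℕ.pred z

    boundary-index-maps : ∀ {t} → (Zagier ∩ Boundary) t → boundary-index t < r
    boundary-index-maps {x , .(x + z) , z} ((eq , _ , 1≤z) , refl) with 1≤⇒≡suc 1≤z | 1≤⇒≡suc (Zagier-x-positive {x} {x + z} {z} eq)
    ... | z′ , refl | x′ , refl =
      double-≤⇒≤ (subst (suc z′ + suc z′ ≤_) (ℕₚ.suc-injective (x+2z≡s {suc x′} {suc z′} eq)) (ℕₚ.m≤n+m _ x′))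

    boundary-point∘index : ∀ {t} → (Zagier ∩ Boundary) t → boundary-point (boundary-index t) ≡ t
    boundary-point∘index {x , .(x + z) , z} ((eq , _ , 1≤z) , refl) with 1≤⇒≡suc 1≤z
    ... | z′ , refl = cong₂ (λ a b → a , b , suc z′)
         (trans (cong (_∸ (suc z′ + suc z′)) (sym (x+2z≡s {x} {suc z′} eq))) (ℕₚ.m+n∸n≡m x (suc z′ + suc z′)))
         (trans (cong (_∸ suc z′) (trans (sym (x+2z≡s {x} {suc z′} eq)) (sym (ℕₚ.+-assoc x (suc z′) (suc z′)))))
                (ℕₚ.m+n∸n≡m (x + suc z′) (suc z′)))

    #boundary≡r : count₃ (zagier? ∩? boundary?) ≡ r
    #boundary≡r = trans (sumWhere-bijection (ℕₚ._<? r) (zagier? ∩? boundary?) (upTo r) (triplesBelow bound)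
                                            (upTo⁺ r) (triplesBelow-unique bound) ∈-upTo⁺ (λ {t} → Zagier⊆triplesBelow {t} ∘ proj₁)
                                            boundary-point boundary-index boundary-point-maps (λ {t} → boundary-index-maps {t})
                                            (λ _ → refl) (λ {t} → boundary-point∘index {t}) (λ _ → 1))
                        (count-upTo r)

  diagonal-counts : count₂ (oddSquares? ∩? SwapOddSquares.Fixed?) + 2 * count₃ (zagier? ∩? boundary?)
                  ≡ sumWhere (divisorPair? ∩? SwapDivisors.Fixed?) proj₁ (pairsBelow bound)
  diagonal-counts with ℕₚ.anyUpTo? (λ s → s * s ≟ m) (suc m)
  ... | no ¬square = trans (cong₂ _+_ (#oddSquaresDiagonal≡0 not-square) (cong (2 *_) (#boundary≡0 not-square)))
                           (sym (Σsquare-divisors≡0 not-square))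
    where
    not-square : ∀ s → s * s ≢ m
    not-square zero    eq = ℕₚ.<-irrefl eq 1≤m
    not-square (suc s) eq = ¬square (suc s , s≤s (ℕₚ.≤-trans (ℕₚ.m≤m*n (suc s) (suc s)) (ℕₚ.≤-reflexive eq)) , eq)
  ... | yes (s , _ , square) with odd-square⇒odd {s} (subst Odd (sym square) m-odd)
  ...   | r , refl = begin
    count₂ (oddSquares? ∩? SwapOddSquares.Fixed?) + 2 * count₃ (zagier? ∩? boundary?)
      ≡⟨ cong₂ _+_ (#oddSquaresDiagonal≡1 r square) (cong (2 *_) (#boundary≡r r square)) ⟩
    1 + 2 * r                                                                           ≡⟨ regroup r ⟩
    suc (r + r)                                                                         ≡⟨ Σsquare-divisors≡s r square ⟨
    sumWhere (divisorPair? ∩? SwapDivisors.Fixed?) proj₁ (pairsBelow bound)             ∎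
    where
    open ≡-Reasoning
    regroup : ∀ r → 1 + 2 * r ≡ suc (r + r)
    regroup = solve-∀

  #oddSquares≡σ₁-mod4 : + count₂ oddSquares? ≡ + σ₁ m [mod + 4 ]
  #oddSquares≡σ₁-mod4 with #zagierDiagonal≡#boundary+#windmillFixed-mod2
  ... | X , Y , parity = mod-trans (a+k*x≡b+k*y⇒a≡b-mod {x = X} {y = Y} 4 combined) (mod-sym σ₁-mod4)
    where
    open ≡-Reasoning
    T  = count₂ oddSquares?
    D  = count₂ (oddSquares? ∩? SwapOddSquares.Fixed?)
    Z  = count₃ (zagier? ∩? SwapYZ.Fixed?)
    B  = count₃ (zagier? ∩? boundary?)
    F  = count₃ (regular? ∩? Windmill.Fixed?)
    G  = count₂ (lowerDivisorPair? ∩? fourDividesGap?)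
    Σs = sumWhere (divisorPair? ∩? SwapDivisors.Fixed?) proj₁ (pairsBelow bound)
    regroup₁ : ∀ a b c → a + 2 * b + 4 * c ≡ a + 2 * (b + 2 * c)
    regroup₁ = solve-∀
    regroup₂ : ∀ a b c d → a + 2 * (b + (c + 2 * d)) ≡ a + 2 * b + 2 * c + 4 * d
    regroup₂ = solve-∀
    combined : T + 4 * X ≡ Σs + 2 * G + 4 * Y
    combined = begin
      T + 4 * X                 ≡⟨ cong (_+ 4 * X) #oddSquares≡diagonal+2#zagierDiagonal ⟩
      D + 2 * Z + 4 * X         ≡⟨ regroup₁ D Z X ⟩
      D + 2 * (Z + 2 * X)       ≡⟨ cong (λ k → D + 2 * k) parity ⟩
      D + 2 * (B + (F + 2 * Y)) ≡⟨ regroup₂ D B F Y ⟩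
      D + 2 * B + 2 * F + 4 * Y ≡⟨ cong₂ (λ a b → a + 2 * b + 4 * Y) diagonal-counts #windmillFixed≡#lowerDivisorPairs ⟩
      Σs + 2 * G + 4 * Y        ∎

open import Data.Nat using (_%_; _*_; _+_)
open import Data.Nat.Tactic.RingSolver using (solve-∀)
open import Data.Integer using (ℤ; +_; _-_) renaming (_*_ to _*ℤ_)
open import Data.Integer.Divisibility using (_∣_)
open import Data.Integer.Divisibility.Signed using (∣⇒∣ᵤ)
open import Data.Product using (∃; _×_; _,_)
open IntegerSums using (_≡_[mod_]; divides-difference; mod-trans; ≡⇒≡-mod)
open PowerSeries using (pow-four-even)
open ThetaSeries using (θ₃²Δ₈; halfθ₂; sixteenθ₃²Δ₈≗16·θ₃²Δ₈; θ₃²Δ₈≋halfθ₂⁴; halfθ₂²-counts)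

lemma3p2 : (m : ℕ) → m % 2 ≡ 1 →
    ∃ λ (a : ℤ) → ((+ 16) *ℤ a ≡ sixteenθ₃²Δ₈ (4 * m)) × ((+ 4) ∣ (a - + σ₁ m))
lemma3p2 m m%2≡1 = θ₃²Δ₈ (4 * m) , sym (sixteenθ₃²Δ₈≗16·θ₃²Δ₈ (4 * m)) , ∣⇒∣ᵤ (divides-difference a≡σ₁)
  where
  four-m : 4 * m ≡ (m + m) + (m + m)
  four-m = quadruple m
    where
    quadruple : ∀ m → 4 * m ≡ (m + m) + (m + m)
    quadruple = solve-∀
  a≡σ₁ : θ₃²Δ₈ (4 * m) ≡ + σ₁ m [mod + 4 ]
  a≡σ₁ = mod-trans (θ₃²Δ₈≋halfθ₂⁴ (4 * m))
        (mod-trans (subst (λ n → pow halfθ₂ 4 n ≡ (halfθ₂ ⊛ halfθ₂) (m + m) [mod + 4 ]) (sym four-m) (pow-four-even halfθ₂ (m + m)))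
        (mod-trans (≡⇒≡-mod (halfθ₂²-counts (m + m)))
                   (RepresentationCounts.#oddSquares≡σ₁-mod4 m (Parity.%2≡1⇒odd m m%2≡1))))
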